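{- Let $p$ be an odd prime, $e\in\mathbb{N}$, $q:=p^e$, and let $\mathcal{D}=(D,Q)$ be a discriminant form whose underlying group is isomorphic to $(\mathbb{Z}/q\mathbb{Z})^n$, where $n\geq5$ if $e=1$ and $n\geq2$ if $e\geq2$. Then $D$ contains two isotropic, mutually orthogonal elements $\delta,\mu$ that are $\mathbb{Z}/p\mathbb{Z}$-linearly independent, i.e. $a\delta+b\mu=0$ with $a,b\in\mathbb{Z}$ implies $a\equiv b\equiv0\pmod p$.
   Context: A discriminant form $\mathcal{D}=(D,Q)$ is a finite abelian group $D$ with $Q:D\to\mathbb{Q}/\mathbb{Z}$ satisfying $Q(a\gamma)=a^2Q(\gamma)$ for $a\in\mathbb{Z}$, such that $(\gamma,\delta)=Q(\gamma+\delta)-Q(\gamma)-Q(\delta)$ is a nondegenerate $\mathbb{Z}$-bilinear form. An element $\delta$ is isotropic if $Q(\delta)=0+\mathbb{Z}$; $\delta,\mu$ are orthogonal if $(\delta,\mu)=0+\mathbb{Z}$. -}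

module Defs where

open import Data.Nat as ℕ using (ℕ; zero; suc)
open import Data.Integer as ℤ using (ℤ; +_)
open import Data.Integer.DivMod using (_%ℕ_; n%ℕd<d)
open import Data.Fin as Fin using (Fin; fromℕ<; toℕ)
open import Data.Vec using (Vec; zipWith; map; replicate)
open import Data.Rational as ℚ using (ℚ; 0ℚ)
open import Data.Product using (∃; _×_)
open import Relation.Binary.PropositionalEquality using (_≡_)
open import Data.Vec.Relation.Unary.All using (All)

ℤ→ℚ : ℤ → ℚ
ℤ→ℚ k = k ℚ./ 1

infix 4 _≈ℚ/ℤ_
_≈ℚ/ℤ_ : ℚ → ℚ → Set
x ≈ℚ/ℤ y = ∃ λ (k : ℤ) → x ℚ.- y ≡ ℤ→ℚ k

-- ℤ/mℤ represented by Fin m (canonical representatives 0,…,m-1).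

red : (k : ℕ) → ℤ → Fin (suc k)
red k z = fromℕ< (n%ℕd<d z (suc k))

_+ₘ_ : ∀ {m} → Fin m → Fin m → Fin m
_+ₘ_ {suc k} x y = red k (+ toℕ x ℤ.+ + toℕ y)

_·ₘ_ : ∀ {m} → ℤ → Fin m → Fin m
_·ₘ_ {suc k} a x = red k (a ℤ.* + toℕ x)

G : ℕ → ℕ → Set
G m n = Vec (Fin m) n

_⊕_ : ∀ {m n} → G m n → G m n → G m n
_⊕_ = zipWith _+ₘ_

_⊙_ : ∀ {m n} → ℤ → G m n → G m n
a ⊙ γ = map (a ·ₘ_) γ

IsZero : ∀ {m n} → G m n → Set
IsZero γ = All (λ x → toℕ x ≡ 0) γ

-- Discriminant forms on the group (ℤ/mℤ)^n.
-- Q : D → ℚ/ℤ is represented by a map to ℚ, all axioms read modulo ℤ.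

module _ {m n : ℕ} (Q : G m n → ℚ) where

  Bil : G m n → G m n → ℚ
  Bil γ δ = Q (γ ⊕ δ) ℚ.- Q γ ℚ.- Q δ

record IsDiscriminantForm {m n : ℕ} (Q : G m n → ℚ) : Set where
  field
    quad   : ∀ (a : ℤ) γ → Q (a ⊙ γ) ≈ℚ/ℤ ℤ→ℚ (a ℤ.* a) ℚ.* Q γ
    bilˡ   : ∀ (a b : ℤ) γ γ' δ →
             Bil Q ((a ⊙ γ) ⊕ (b ⊙ γ')) δ
               ≈ℚ/ℤ ℤ→ℚ a ℚ.* Bil Q γ δ ℚ.+ ℤ→ℚ b ℚ.* Bil Q γ' δ
    bilʳ   : ∀ (a b : ℤ) γ δ δ' →
             Bil Q γ ((a ⊙ δ) ⊕ (b ⊙ δ'))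
               ≈ℚ/ℤ ℤ→ℚ a ℚ.* Bil Q γ δ ℚ.+ ℤ→ℚ b ℚ.* Bil Q γ δ'
    nondeg : ∀ γ → (∀ δ → Bil Q γ δ ≈ℚ/ℤ 0ℚ) → IsZero γ

-- Write m = pᵉ. Since m is odd, 2 Q(γ) ≡ B(γ, γ) determines Q(γ) mod ℤ, so it suffices to find
-- δ, μ with B(δ, δ), B(μ, μ), B(δ, μ) ∈ ℤ that are independent mod p. For e ≥ 2 take δ = r e₁ and
-- μ = r e₂ with r = p^(e-1): every value of B(rγ, rγ′) = r² B(γ, γ′) lies in ℤ because m ∣ r² and
-- m B(γ, γ′) ∈ ℤ. For e = 1, p B restricted to the first five coordinates is a symmetric integer form
-- mod p. Every ternary form over 𝔽ₚ is isotropic (completing squares, and counting squares for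
-- the binary form a L² + M²), which gives an isotropic v in the span of e₁, e₂, e₃; a second
-- isotropic vector is found in the span of three vectors of v^⊥ that vanish at a coordinate where v
-- does not, and this makes the two independent.

module Submission where

open import Defs
open import Data.Nat as ℕ using (ℕ; zero; suc; _^_; _≤_; s≤s; z≤n)
import Data.Nat.Properties as ℕP
import Data.Nat.DivMod as ℕM
import Data.Nat.Divisibility as ℕD
open import Data.Nat.Primality using (Prime; euclidsLemma; prime⇒irreducible; prime⇒nonZero; prime⇒nonTrivial)
import Data.Nat.Tactic.RingSolver as ℕSolver
open import Data.Integer as ℤ using (ℤ; +_)
import Data.Integer.Properties as ℤP
open import Algebra.Properties.Semiring.Sum ℤP.+-*-semiring using (sum; sum-syntax; ∑-distrib-+; ∑-comm; *-distribˡ-sum; sum-cong-≗)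
open import Data.Integer.Divisibility using (_∣_)
import Data.Integer.Divisibility.Signed as ℤS
open import Data.Integer.DivMod using (_%ℕ_; _/ℕ_; n%ℕd<d; a≡a%ℕn+[a/ℕn]*n)
open import Data.Integer.Tactic.RingSolver using (solve-∀)
open import Data.Rational as ℚ using (ℚ; 0ℚ; 1ℚ; toℚᵘ; fromℚᵘ)
import Data.Rational.Properties as ℚP
import Algebra.Properties.Monoid.Sum ℚP.+-0-monoid as ℚΣ
open import Data.Rational.Unnormalised as ℚᵘ using (mkℚᵘ; *≡*)
import Data.Rational.Unnormalised.Properties as ℚᵘP
import Data.Rational.Solver as ℚSolver
open import Data.Fin as Fin using (Fin; toℕ; fromℕ<; splitAt; join)
open import Data.Fin.Patterns using (0F; 1F; 2F; 3F; 4F)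
import Data.Fin.Properties as FinP
open import Data.Vec using ([]; _∷_; replicate; lookup)
import Data.Vec.Properties as VecP
import Data.Vec.Relation.Unary.All as All
open import Data.List using (List; []; _∷_)
open import Data.Product using (∃; ∃₂; Σ; _×_; _,_; proj₁; proj₂)
open import Data.Sum using (_⊎_; inj₁; inj₂; [_,_])
open import Data.Empty using (⊥-elim)
open import Relation.Nullary using (¬_; Dec; yes; no; ¬?; _×-dec_)
open import Relation.Binary.Definitions using (tri<; tri≈; tri>)
open import Function using (_∘_)
open import Relation.Binary.PropositionalEquality hiding ([_])

Odd : ℕ → Set
Odd m = ∃ λ h → m ≡ suc (h ℕ.+ h)

odd-^ : ∀ {p} → Odd p → ∀ e → Odd (p ^ e)
odd-^ _            zero    = 0 , refl
odd-^ (h , p≡2h+1) (suc e) with odd-^ (h , p≡2h+1) e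
... | h′ , pᵉ≡2h′+1 = h′ ℕ.+ h ℕ.* suc (h′ ℕ.+ h′) , trans (cong₂ ℕ._*_ p≡2h+1 pᵉ≡2h′+1) (ring h h′)
  where
  ring : ∀ h h′ → suc (h ℕ.+ h) ℕ.* suc (h′ ℕ.+ h′) ≡ suc ((h′ ℕ.+ h ℕ.* suc (h′ ℕ.+ h′)) ℕ.+ (h′ ℕ.+ h ℕ.* suc (h′ ℕ.+ h′)))
  ring = ℕSolver.solve-∀

-- ℚ modulo ℤ

module ℚ/ℤ where

  open ℚSolver.+-*-Solver using (solve; _:+_; _:-_; _:*_; :-_; con; _:=_)

  private
    toℚᵘ-ℤ→ℚ : ∀ k → toℚᵘ (ℤ→ℚ k) ℚᵘ.≃ mkℚᵘ k 0
    toℚᵘ-ℤ→ℚ k = ℚP.toℚᵘ-fromℚᵘ (mkℚᵘ k 0)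

  ℤ→ℚ-+ : ∀ a b → ℤ→ℚ (a ℤ.+ b) ≡ ℤ→ℚ a ℚ.+ ℤ→ℚ b
  ℤ→ℚ-+ a b = ℚP.toℚᵘ-injective (ℚᵘP.≃-trans (toℚᵘ-ℤ→ℚ (a ℤ.+ b)) (ℚᵘP.≃-trans (*≡* (ring a b))
    (ℚᵘP.≃-sym (ℚᵘP.≃-trans (ℚP.toℚᵘ-homo-+ (ℤ→ℚ a) (ℤ→ℚ b)) (ℚᵘP.+-cong (toℚᵘ-ℤ→ℚ a) (toℚᵘ-ℤ→ℚ b))))))
    where
    ring : ∀ a b → (a ℤ.+ b) ℤ.* + 1 ≡ (a ℤ.* + 1 ℤ.+ b ℤ.* + 1) ℤ.* + 1
    ring = solve-∀

  ℤ→ℚ-* : ∀ a b → ℤ→ℚ (a ℤ.* b) ≡ ℤ→ℚ a ℚ.* ℤ→ℚ b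
  ℤ→ℚ-* a b = ℚP.toℚᵘ-injective (ℚᵘP.≃-trans (toℚᵘ-ℤ→ℚ (a ℤ.* b)) (ℚᵘP.≃-sym
    (ℚᵘP.≃-trans (ℚP.toℚᵘ-homo-* (ℤ→ℚ a) (ℤ→ℚ b)) (ℚᵘP.*-cong (toℚᵘ-ℤ→ℚ a) (toℚᵘ-ℤ→ℚ b)))))

  ℤ→ℚ-neg : ∀ a → ℤ→ℚ (ℤ.- a) ≡ ℚ.- ℤ→ℚ a
  ℤ→ℚ-neg a = ℚP.toℚᵘ-injective (ℚᵘP.≃-trans (toℚᵘ-ℤ→ℚ (ℤ.- a))
    (ℚᵘP.≃-sym (ℚᵘP.≃-trans (ℚP.toℚᵘ-homo‿- (ℤ→ℚ a)) (ℚᵘP.-‿cong (toℚᵘ-ℤ→ℚ a)))))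

  ℤ→ℚ-injective : ∀ {a b} → ℤ→ℚ a ≡ ℤ→ℚ b → a ≡ b
  ℤ→ℚ-injective {a} {b} eq with ℚᵘP.≃-trans (ℚᵘP.≃-sym (toℚᵘ-ℤ→ℚ a)) (ℚᵘP.≃-trans (ℚP.toℚᵘ-cong eq) (toℚᵘ-ℤ→ℚ b))
  ... | *≡* eq′ = trans (sym (ℤP.*-identityʳ a)) (trans eq′ (ℤP.*-identityʳ b))

  -- x and y cannot be inferred from a proof of the ∃-type x ≈ℚ/ℤ y; the record makes them inferable.
  infix 4 _≈_
  record _≈_ (x y : ℚ) : Set where
    constructor mk≈
    field un≈ : x ≈ℚ/ℤ y
  open _≈_ public

  ≈-reflexive : ∀ {x y} → x ≡ y → x ≈ y
  ≈-reflexive {x} refl = mk≈ (+ 0 , solve 1 (λ x → x :- x := con 0ℚ) refl x)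

  ≈-refl : ∀ {x} → x ≈ x
  ≈-refl = ≈-reflexive refl

  ≈-sym : ∀ {x y} → x ≈ y → y ≈ x
  ≈-sym {x} {y} (mk≈ (k , eq)) = mk≈ (ℤ.- k , (begin
    y ℚ.- x        ≡⟨ solve 2 (λ x y → y :- x := :- (x :- y)) refl x y ⟩
    ℚ.- (x ℚ.- y)  ≡⟨ cong ℚ.-_ eq ⟩
    ℚ.- ℤ→ℚ k      ≡⟨ ℤ→ℚ-neg k ⟨
    ℤ→ℚ (ℤ.- k)    ∎))
    where open ≡-Reasoning

  ≈-trans : ∀ {x y z} → x ≈ y → y ≈ z → x ≈ z
  ≈-trans {x} {y} {z} (mk≈ (k , eq)) (mk≈ (k′ , eq′)) = mk≈ (k ℤ.+ k′ , (begin
    x ℚ.- z                    ≡⟨ solve 3 (λ x y z → x :- z := (x :- y) :+ (y :- z)) refl x y z ⟩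
    (x ℚ.- y) ℚ.+ (y ℚ.- z)    ≡⟨ cong₂ ℚ._+_ eq eq′ ⟩
    ℤ→ℚ k ℚ.+ ℤ→ℚ k′           ≡⟨ ℤ→ℚ-+ k k′ ⟨
    ℤ→ℚ (k ℤ.+ k′)             ∎))
    where open ≡-Reasoning

  ≈-+ : ∀ {x x′ y y′} → x ≈ y → x′ ≈ y′ → x ℚ.+ x′ ≈ y ℚ.+ y′
  ≈-+ {x} {x′} {y} {y′} (mk≈ (k , eq)) (mk≈ (k′ , eq′)) = mk≈ (k ℤ.+ k′ , (begin
    (x ℚ.+ x′) ℚ.- (y ℚ.+ y′)    ≡⟨ solve 4 (λ x x′ y y′ → (x :+ x′) :- (y :+ y′) := (x :- y) :+ (x′ :- y′)) refl x x′ y y′ ⟩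
    (x ℚ.- y) ℚ.+ (x′ ℚ.- y′)    ≡⟨ cong₂ ℚ._+_ eq eq′ ⟩
    ℤ→ℚ k ℚ.+ ℤ→ℚ k′             ≡⟨ ℤ→ℚ-+ k k′ ⟨
    ℤ→ℚ (k ℤ.+ k′)               ∎))
    where open ≡-Reasoning

  ≈-*ℤ : ∀ a {x y} → x ≈ y → ℤ→ℚ a ℚ.* x ≈ ℤ→ℚ a ℚ.* y
  ≈-*ℤ a {x} {y} (mk≈ (k , eq)) = mk≈ (a ℤ.* k , (begin
    ℤ→ℚ a ℚ.* x ℚ.- ℤ→ℚ a ℚ.* y    ≡⟨ solve 3 (λ a x y → a :* x :- a :* y := a :* (x :- y)) refl (ℤ→ℚ a) x y ⟩
    ℤ→ℚ a ℚ.* (x ℚ.- y)            ≡⟨ cong (ℤ→ℚ a ℚ.*_) eq ⟩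
    ℤ→ℚ a ℚ.* ℤ→ℚ k                ≡⟨ ℤ→ℚ-* a k ⟨
    ℤ→ℚ (a ℤ.* k)                  ∎))
    where open ≡-Reasoning

  ≈-sum : ∀ {N} {f g : Fin N → ℚ} → (∀ i → f i ≈ g i) → ℚΣ.sum f ≈ ℚΣ.sum g
  ≈-sum {zero}  _   = ≈-refl
  ≈-sum {suc N} f≈g = ≈-+ (f≈g 0F) (≈-sum (f≈g ∘ Fin.suc))

  ℤ→ℚ≈0 : ∀ k → ℤ→ℚ k ≈ 0ℚ
  ℤ→ℚ≈0 k = mk≈ (k , solve 1 (λ x → x :- con 0ℚ := x) refl (ℤ→ℚ k))

  ≈-subst : ∀ {x x′ y y′} → x ≡ x′ → y ≡ y′ → x ≈ y → x′ ≈ y′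
  ≈-subst refl refl x≈y = x≈y

module _ {n} {k t : Fin (suc (suc n))} (k≢t : k ≢ t) where

  other : Fin n → Fin (suc (suc n))
  other i = Fin.punchIn k (Fin.punchIn (Fin.punchOut k≢t) i)

  other≢k : ∀ i → other i ≢ k
  other≢k i = FinP.punchInᵢ≢i k _

  other≢t : ∀ i → other i ≢ t
  other≢t i eq = FinP.punchInᵢ≢i (Fin.punchOut k≢t) i
    (FinP.punchIn-injective k _ _ (trans eq (sym (FinP.punchIn-punchOut k≢t))))

  other-≢ : ∀ {i j} → i ≢ j → other i ≢ other j
  other-≢ i≢j eq = i≢j (FinP.punchIn-injective _ _ _ (FinP.punchIn-injective k _ _ eq))

-- Integer bilinear forms

ternaryForm : (a b c d e f s₀ s₁ s₂ : ℤ) → ℤ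
ternaryForm a b c d e f s₀ s₁ s₂ =
  a ℤ.* s₀ ℤ.* s₀ ℤ.+ b ℤ.* s₁ ℤ.* s₁ ℤ.+ c ℤ.* s₂ ℤ.* s₂ ℤ.+ (d ℤ.* s₀ ℤ.* s₁ ℤ.+ d ℤ.* s₁ ℤ.* s₀)
    ℤ.+ (e ℤ.* s₀ ℤ.* s₂ ℤ.+ e ℤ.* s₂ ℤ.* s₀) ℤ.+ (f ℤ.* s₁ ℤ.* s₂ ℤ.+ f ℤ.* s₂ ℤ.* s₁)

module _ where

  open import Data.Integer using (_+_; _*_)

  basis : ∀ {N} → Fin N → Fin N → ℤ
  basis i j with i Fin.≟ j
  ... | yes _ = + 1
  ... | no _  = + 0

  basis-same : ∀ {N} (i : Fin N) → basis i i ≡ + 1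
  basis-same i with i Fin.≟ i
  ... | yes _   = refl
  ... | no i≢i = ⊥-elim (i≢i refl)

  basis-diff : ∀ {N} {i j : Fin N} → i ≢ j → basis i j ≡ + 0
  basis-diff {i = i} {j} i≢j with i Fin.≟ j
  ... | yes i≡j = ⊥-elim (i≢j i≡j)
  ... | no _    = refl

  lin₂ : ∀ {N} → ℤ → ℤ → (Fin N → ℤ) → (Fin N → ℤ) → Fin N → ℤ
  lin₂ s₀ s₁ g₀ g₁ i = s₀ * g₀ i + s₁ * g₁ i

  lin₃ : ∀ {N} → ℤ → ℤ → ℤ → (Fin N → ℤ) → (Fin N → ℤ) → (Fin N → ℤ) → Fin N → ℤ
  lin₃ s₀ s₁ s₂ g₀ g₁ g₂ i = s₀ * g₀ i + s₁ * g₁ i + s₂ * g₂ i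

  ∑-lin₃ : ∀ {N} s₀ s₁ s₂ (f₀ f₁ f₂ : Fin N → ℤ) →
           sum (lin₃ s₀ s₁ s₂ f₀ f₁ f₂) ≡ s₀ * sum f₀ + s₁ * sum f₁ + s₂ * sum f₂
  ∑-lin₃ {N} s₀ s₁ s₂ f₀ f₁ f₂ = begin
    ∑[ i < N ] (s₀ * f₀ i + s₁ * f₁ i + s₂ * f₂ i)
      ≡⟨ ∑-distrib-+ (λ i → s₀ * f₀ i + s₁ * f₁ i) (λ i → s₂ * f₂ i) ⟩
    ∑[ i < N ] (s₀ * f₀ i + s₁ * f₁ i) + ∑[ i < N ] (s₂ * f₂ i)
      ≡⟨ cong (_+ ∑[ i < N ] (s₂ * f₂ i)) (∑-distrib-+ (λ i → s₀ * f₀ i) (λ i → s₁ * f₁ i)) ⟩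
    ∑[ i < N ] (s₀ * f₀ i) + ∑[ i < N ] (s₁ * f₁ i) + ∑[ i < N ] (s₂ * f₂ i)
      ≡⟨ cong₂ _+_ (cong₂ _+_ (*-distribˡ-sum s₀ f₀) (*-distribˡ-sum s₁ f₁)) (*-distribˡ-sum s₂ f₂) ⟨
    s₀ * sum f₀ + s₁ * sum f₁ + s₂ * sum f₂ ∎
    where open ≡-Reasoning

  module BilinearForm {N : ℕ} (c : Fin N → Fin N → ℤ) (c-sym : ∀ i j → c i j ≡ c j i) where

    β : (Fin N → ℤ) → (Fin N → ℤ) → ℤ
    β X Y = ∑[ i < N ] ∑[ j < N ] (X i * c i j * Y j)

    β-sym : ∀ X Y → β X Y ≡ β Y X
    β-sym X Y = trans (∑-comm (λ i j → X i * c i j * Y j))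
      (sum-cong-≗ λ j → sum-cong-≗ λ i → trans (cong (λ cij → X i * cij * Y j) (c-sym i j)) (ring (X i) (c j i) (Y j)))
      where
      ring : ∀ x c y → x * c * y ≡ y * c * x
      ring = solve-∀

    β-lin₃ˡ : ∀ s₀ s₁ s₂ g₀ g₁ g₂ Z → β (lin₃ s₀ s₁ s₂ g₀ g₁ g₂) Z ≡ s₀ * β g₀ Z + s₁ * β g₁ Z + s₂ * β g₂ Z
    β-lin₃ˡ s₀ s₁ s₂ g₀ g₁ g₂ Z = begin
      ∑[ i < N ] ∑[ j < N ] (lin₃ s₀ s₁ s₂ g₀ g₁ g₂ i * c i j * Z j)
        ≡⟨ sum-cong-≗ (λ i → trans (sum-cong-≗ λ j → ring s₀ s₁ s₂ (g₀ i) (g₁ i) (g₂ i) (c i j) (Z j))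
                                  (∑-lin₃ s₀ s₁ s₂ (λ j → g₀ i * c i j * Z j) (λ j → g₁ i * c i j * Z j) (λ j → g₂ i * c i j * Z j))) ⟩
      ∑[ i < N ] lin₃ s₀ s₁ s₂ (λ i → ∑[ j < N ] (g₀ i * c i j * Z j)) (λ i → ∑[ j < N ] (g₁ i * c i j * Z j)) (λ i → ∑[ j < N ] (g₂ i * c i j * Z j)) i
        ≡⟨ ∑-lin₃ s₀ s₁ s₂ (λ i → ∑[ j < N ] (g₀ i * c i j * Z j)) (λ i → ∑[ j < N ] (g₁ i * c i j * Z j)) (λ i → ∑[ j < N ] (g₂ i * c i j * Z j)) ⟩
      s₀ * β g₀ Z + s₁ * β g₁ Z + s₂ * β g₂ Z ∎
      where
      open ≡-Reasoning
      ring : ∀ s₀ s₁ s₂ a₀ a₁ a₂ c z → (s₀ * a₀ + s₁ * a₁ + s₂ * a₂) * c * z ≡ s₀ * (a₀ * c * z) + s₁ * (a₁ * c * z) + s₂ * (a₂ * c * z)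
      ring = solve-∀

    β-congʳ : ∀ X {Y Y′} → (∀ i → Y i ≡ Y′ i) → β X Y ≡ β X Y′
    β-congʳ X Y≗Y′ = sum-cong-≗ λ i → sum-cong-≗ λ j → cong (X i * c i j *_) (Y≗Y′ j)

    β-lin₃ʳ : ∀ s₀ s₁ s₂ g₀ g₁ g₂ Z → β Z (lin₃ s₀ s₁ s₂ g₀ g₁ g₂) ≡ s₀ * β Z g₀ + s₁ * β Z g₁ + s₂ * β Z g₂
    β-lin₃ʳ s₀ s₁ s₂ g₀ g₁ g₂ Z = begin
      β Z (lin₃ s₀ s₁ s₂ g₀ g₁ g₂)                ≡⟨ β-sym Z _ ⟩
      β (lin₃ s₀ s₁ s₂ g₀ g₁ g₂) Z                ≡⟨ β-lin₃ˡ s₀ s₁ s₂ g₀ g₁ g₂ Z ⟩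
      s₀ * β g₀ Z + s₁ * β g₁ Z + s₂ * β g₂ Z     ≡⟨ cong₂ _+_ (cong₂ _+_ (cong (s₀ *_) (β-sym g₀ Z)) (cong (s₁ *_) (β-sym g₁ Z))) (cong (s₂ *_) (β-sym g₂ Z)) ⟩
      s₀ * β Z g₀ + s₁ * β Z g₁ + s₂ * β Z g₂     ∎
      where open ≡-Reasoning

    β-lin₂ʳ : ∀ s₀ s₁ g₀ g₁ Z → β Z (lin₂ s₀ s₁ g₀ g₁) ≡ s₀ * β Z g₀ + s₁ * β Z g₁
    β-lin₂ʳ s₀ s₁ g₀ g₁ Z = begin
      β Z (lin₂ s₀ s₁ g₀ g₁)                        ≡⟨ β-congʳ Z (λ i → ring₁ s₀ s₁ (g₀ i) (g₁ i)) ⟩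
      β Z (lin₃ s₀ s₁ (+ 0) g₀ g₁ g₁)                ≡⟨ β-lin₃ʳ s₀ s₁ (+ 0) g₀ g₁ g₁ Z ⟩
      s₀ * β Z g₀ + s₁ * β Z g₁ + + 0 * β Z g₁       ≡⟨ ring₂ s₀ s₁ (β Z g₀) (β Z g₁) ⟩
      s₀ * β Z g₀ + s₁ * β Z g₁                      ∎
      where
      open ≡-Reasoning
      ring₁ : ∀ s₀ s₁ a b → s₀ * a + s₁ * b ≡ s₀ * a + s₁ * b + + 0 * b
      ring₁ = solve-∀
      ring₂ : ∀ s₀ s₁ a b → s₀ * a + s₁ * b + + 0 * b ≡ s₀ * a + s₁ * b
      ring₂ = solve-∀

    β-lin₃-diag : ∀ s₀ s₁ s₂ g₀ g₁ g₂ → let v = lin₃ s₀ s₁ s₂ g₀ g₁ g₂ in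
      β v v ≡ ternaryForm (β g₀ g₀) (β g₁ g₁) (β g₂ g₂) (β g₀ g₁) (β g₀ g₂) (β g₁ g₂) s₀ s₁ s₂
    β-lin₃-diag s₀ s₁ s₂ g₀ g₁ g₂ = begin
      β v v
        ≡⟨ β-lin₃ˡ s₀ s₁ s₂ g₀ g₁ g₂ v ⟩
      s₀ * β g₀ v + s₁ * β g₁ v + s₂ * β g₂ v
        ≡⟨ cong₂ _+_ (cong₂ _+_ (cong (s₀ *_) (β-lin₃ʳ s₀ s₁ s₂ g₀ g₁ g₂ g₀)) (cong (s₁ *_) (β-lin₃ʳ s₀ s₁ s₂ g₀ g₁ g₂ g₁)))
                     (cong (s₂ *_) (β-lin₃ʳ s₀ s₁ s₂ g₀ g₁ g₂ g₂)) ⟩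
      s₀ * (s₀ * β g₀ g₀ + s₁ * β g₀ g₁ + s₂ * β g₀ g₂) + s₁ * (s₀ * β g₁ g₀ + s₁ * β g₁ g₁ + s₂ * β g₁ g₂)
        + s₂ * (s₀ * β g₂ g₀ + s₁ * β g₂ g₁ + s₂ * β g₂ g₂)
        ≡⟨ cong₂ (λ b₁₀ b₂₀ → s₀ * (s₀ * β g₀ g₀ + s₁ * β g₀ g₁ + s₂ * β g₀ g₂) + s₁ * (s₀ * b₁₀ + s₁ * β g₁ g₁ + s₂ * β g₁ g₂)
                      + s₂ * (s₀ * b₂₀ + s₁ * β g₂ g₁ + s₂ * β g₂ g₂)) (β-sym g₁ g₀) (β-sym g₂ g₀) ⟩
      s₀ * (s₀ * β g₀ g₀ + s₁ * β g₀ g₁ + s₂ * β g₀ g₂) + s₁ * (s₀ * β g₀ g₁ + s₁ * β g₁ g₁ + s₂ * β g₁ g₂)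
        + s₂ * (s₀ * β g₀ g₂ + s₁ * β g₂ g₁ + s₂ * β g₂ g₂)
        ≡⟨ cong (λ b₂₁ → s₀ * (s₀ * β g₀ g₀ + s₁ * β g₀ g₁ + s₂ * β g₀ g₂) + s₁ * (s₀ * β g₀ g₁ + s₁ * β g₁ g₁ + s₂ * β g₁ g₂)
                      + s₂ * (s₀ * β g₀ g₂ + s₁ * b₂₁ + s₂ * β g₂ g₂)) (β-sym g₂ g₁) ⟩
      s₀ * (s₀ * β g₀ g₀ + s₁ * β g₀ g₁ + s₂ * β g₀ g₂) + s₁ * (s₀ * β g₀ g₁ + s₁ * β g₁ g₁ + s₂ * β g₁ g₂)
        + s₂ * (s₀ * β g₀ g₂ + s₁ * β g₁ g₂ + s₂ * β g₂ g₂)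
        ≡⟨ ring s₀ s₁ s₂ (β g₀ g₀) (β g₀ g₁) (β g₀ g₂) (β g₁ g₁) (β g₁ g₂) (β g₂ g₂) ⟩
      ternaryForm (β g₀ g₀) (β g₁ g₁) (β g₂ g₂) (β g₀ g₁) (β g₀ g₂) (β g₁ g₂) s₀ s₁ s₂ ∎
      where
      open ≡-Reasoning
      v = lin₃ s₀ s₁ s₂ g₀ g₁ g₂
      ring : ∀ s₀ s₁ s₂ b₀₀ b₀₁ b₀₂ b₁₁ b₁₂ b₂₂ →
        s₀ * (s₀ * b₀₀ + s₁ * b₀₁ + s₂ * b₀₂) + s₁ * (s₀ * b₀₁ + s₁ * b₁₁ + s₂ * b₁₂) + s₂ * (s₀ * b₀₂ + s₁ * b₁₂ + s₂ * b₂₂)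
          ≡ b₀₀ * s₀ * s₀ + b₁₁ * s₁ * s₁ + b₂₂ * s₂ * s₂ + (b₀₁ * s₀ * s₁ + b₀₁ * s₁ * s₀)
            + (b₀₂ * s₀ * s₂ + b₀₂ * s₂ * s₀) + (b₁₂ * s₁ * s₂ + b₁₂ * s₂ * s₁)
      ring = solve-∀

-- Arithmetic modulo an odd prime

module ModPrime (p : ℕ) (p-prime : Prime p) (p≢2 : p ≢ 2) where

  open import Data.Integer using (_+_; _*_; -_; _-_; ∣_∣)

  instance
    p-nonZero : ℕ.NonZero p
    p-nonZero = prime⇒nonZero p-prime

  1<p : 1 ℕ.< p
  1<p = ℕ.nonTrivial⇒n>1 p {{prime⇒nonTrivial p-prime}}

  -- + p ∣ x unfolds to p ∣ ∣ x ∣, from which x cannot be inferred; the record makes it inferable.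
  infix 4 p∣_
  record p∣_ (x : ℤ) : Set where
    constructor mk∣
    field un∣ : + p ∣ x
  open p∣_ public

  p∣? : ∀ x → Dec (p∣ x)
  p∣? x with p ℕD.∣? ∣ x ∣
  ... | yes p∣x = yes (mk∣ p∣x)
  ... | no p∤x = no (λ p∣x → p∤x (un∣ p∣x))

  private
    toSigned : ∀ {x} → p∣ x → + p ℤS.∣ x
    toSigned {x} p∣x = ℤS.∣ᵤ⇒∣ {+ p} {x} (un∣ p∣x)

    fromSigned : ∀ {x} → + p ℤS.∣ x → p∣ x
    fromSigned {x} p∣x = mk∣ (ℤS.∣⇒∣ᵤ {+ p} {x} p∣x)

  p∣-≡ : ∀ {x y} → x ≡ y → p∣ x → p∣ y
  p∣-≡ = subst p∣_

  p∣0 : p∣ + 0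
  p∣0 = mk∣ (p ℕD.∣0)

  p∣-x-x : ∀ x → p∣ (x - x)
  p∣-x-x x = p∣-≡ (sym (ℤP.+-inverseʳ x)) p∣0

  p∣-+ : ∀ {x y} → p∣ x → p∣ y → p∣ (x + y)
  p∣-+ {x} {y} p∣x p∣y = fromSigned (ℤS.∣m∣n⇒∣m+n {+ p} {x} {y} (toSigned p∣x) (toSigned p∣y))

  p∣-*ˡ : ∀ x {y} → p∣ y → p∣ (x * y)
  p∣-*ˡ x {y} p∣y = fromSigned (ℤS.∣n⇒∣m*n {+ p} x {y} (toSigned p∣y))

  p∣-*ʳ : ∀ {x} y → p∣ x → p∣ (x * y)
  p∣-*ʳ {x} y p∣x = fromSigned (ℤS.∣m⇒∣m*n {+ p} {x} y (toSigned p∣x))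

  p∣-neg : ∀ {x} → p∣ x → p∣ (- x)
  p∣-neg {x} p∣x = fromSigned (ℤS.∣m⇒∣-m {+ p} {x} (toSigned p∣x))

  p∣-*p : ∀ x → p∣ (x * + p)
  p∣-*p x = fromSigned (ℤS.∣n⇒∣m*n {+ p} x {+ p} (ℤS.∣-refl {+ p}))

  p∣-*⇒⊎ : ∀ x y → p∣ (x * y) → p∣ x ⊎ p∣ y
  p∣-*⇒⊎ x y p∣xy with euclidsLemma ∣ x ∣ ∣ y ∣ p-prime (subst (p ℕD.∣_) (ℤP.abs-* x y) (un∣ p∣xy))
  ... | inj₁ p∣x = inj₁ (mk∣ p∣x)
  ... | inj₂ p∣y = inj₂ (mk∣ p∣y)

  p∣-cancelˡ : ∀ x y → ¬ p∣ x → p∣ (x * y) → p∣ y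
  p∣-cancelˡ x y p∤x p∣xy = [ (λ p∣x → ⊥-elim (p∤x p∣x)) , (λ p∣y → p∣y) ] (p∣-*⇒⊎ x y p∣xy)

  p∤-* : ∀ x y → ¬ p∣ x → ¬ p∣ y → ¬ p∣ (x * y)
  p∤-* x y p∤x p∤y p∣xy = [ p∤x , p∤y ] (p∣-*⇒⊎ x y p∣xy)

  p∤-between-0-p : ∀ x → 0 ℕ.< x → x ℕ.< p → ¬ p∣ (+ x)
  p∤-between-0-p (suc x) _ x<p p∣x = ℕP.<⇒≱ x<p (ℕD.∣⇒≤ (un∣ p∣x))

  p∤1 : ¬ p∣ (+ 1)
  p∤1 = p∤-between-0-p 1 (s≤s z≤n) 1<p

  reduce : ℤ → Fin p
  reduce z = fromℕ< (n%ℕd<d z p)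

  reduce-≡⇒p∣- : ∀ z z′ → reduce z ≡ reduce z′ → p∣ (z - z′)
  reduce-≡⇒p∣- z z′ eq = p∣-≡ (sym z-z′≡) (p∣-*p (z /ℕ p - z′ /ℕ p))
    where
    open ≡-Reasoning
    rem≡ : z %ℕ p ≡ z′ %ℕ p
    rem≡ = trans (sym (FinP.toℕ-fromℕ< (n%ℕd<d z p))) (trans (cong toℕ eq) (FinP.toℕ-fromℕ< (n%ℕd<d z′ p)))
    ring : ∀ r q q′ P → (r + q * P) - (r + q′ * P) ≡ (q - q′) * P
    ring = solve-∀
    z-z′≡ : z - z′ ≡ (z /ℕ p - z′ /ℕ p) * + p
    z-z′≡ = begin
      z - z′
        ≡⟨ cong₂ _-_ (a≡a%ℕn+[a/ℕn]*n z p) (a≡a%ℕn+[a/ℕn]*n z′ p) ⟩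
      (+ (z %ℕ p) + z /ℕ p * + p) - (+ (z′ %ℕ p) + z′ /ℕ p * + p)
        ≡⟨ cong (λ r → (+ (z %ℕ p) + z /ℕ p * + p) - (+ r + z′ /ℕ p * + p)) rem≡ ⟨
      (+ (z %ℕ p) + z /ℕ p * + p) - (+ (z %ℕ p) + z′ /ℕ p * + p)
        ≡⟨ ring (+ (z %ℕ p)) (z /ℕ p) (z′ /ℕ p) (+ p) ⟩
      (z /ℕ p - z′ /ℕ p) * + p ∎

  p-odd : Odd p
  p-odd with p ℕ.% 2 | ℕM.m%n<n p 2 | ℕM.m≡m%n+[m/n]*n p 2
  ... | 0 | _ | eq = ⊥-elim (p≢2 (2∣p⇒p≡2 (prime⇒irreducible p-prime (ℕD.divides (p ℕ./ 2) eq))))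
    where
    2∣p⇒p≡2 : 2 ≡ 1 ⊎ 2 ≡ p → p ≡ 2
    2∣p⇒p≡2 (inj₂ 2≡p) = sym 2≡p
  ... | 1 | _ | eq = p ℕ./ 2 , trans eq (cong suc (trans (ℕP.*-comm (p ℕ./ 2) 2) (cong (p ℕ./ 2 ℕ.+_) (ℕP.+-identityʳ _))))
  ... | suc (suc _) | s≤s (s≤s ()) | _

  private
    h : ℕ
    h = suc (proj₁ p-odd)

    p≡2h-1 : p ≡ suc (proj₁ p-odd ℕ.+ proj₁ p-odd)
    p≡2h-1 = proj₂ p-odd

    sum<p : ∀ {x y} → x ℕ.< h → y ℕ.< h → x ℕ.+ y ℕ.< p
    sum<p x<h y<h = subst (_ ℕ.<_) (sym p≡2h-1) (s≤s (ℕP.+-mono-≤ (ℕP.≤-pred x<h) (ℕP.≤-pred y<h)))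

    scaled-squares-distinct< : ∀ C x y → ¬ p∣ C → x ℕ.< y → y ℕ.< h → ¬ p∣ (C * + x * + x - C * + y * + y)
    scaled-squares-distinct< C x y p∤C x<y y<h p∣diff = [ p∤-between-0-p d 0<d d<p , p∤-between-0-p (x ℕ.+ x ℕ.+ d) 0<s s<p ] (p∣-*⇒⊎ (+ d) (+ (x ℕ.+ x ℕ.+ d)) p∣d*s)
      where
      d = y ℕ.∸ x
      x+d≡y : x ℕ.+ d ≡ y
      x+d≡y = ℕP.m+[n∸m]≡n (ℕP.<⇒≤ x<y)
      0<d : 0 ℕ.< d
      0<d = ℕP.m<n⇒0<n∸m x<y
      d<p : d ℕ.< p
      d<p = ℕP.≤-<-trans (ℕP.m∸n≤m y x) (ℕP.≤-<-trans (ℕP.m≤n+m y 0) (sum<p {0} (s≤s z≤n) y<h))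
      0<s : 0 ℕ.< x ℕ.+ x ℕ.+ d
      0<s = ℕP.<-≤-trans 0<d (ℕP.m≤n+m d (x ℕ.+ x))
      s<p : x ℕ.+ x ℕ.+ d ℕ.< p
      s<p = subst (ℕ._< p) (sym (trans (ℕP.+-assoc x x d) (cong (x ℕ.+_) x+d≡y))) (sum<p (ℕP.<-trans x<y y<h) y<h)
      ring : ∀ C x d → - (C * x * x - C * (x + d) * (x + d)) ≡ C * (d * (x + x + d))
      ring = solve-∀
      p∣d*s : p∣ (+ d * + (x ℕ.+ x ℕ.+ d))
      p∣d*s = p∣-cancelˡ C _ p∤C (p∣-≡ eq (p∣-neg p∣diff))
        where
        eq : - (C * + x * + x - C * + y * + y) ≡ C * (+ d * + (x ℕ.+ x ℕ.+ d))
        eq = begin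
          - (C * + x * + x - C * + y * + y)                   ≡⟨ cong (λ Y → - (C * + x * + x - C * Y * Y)) (cong +_ (sym x+d≡y)) ⟩
          - (C * + x * + x - C * + (x ℕ.+ d) * + (x ℕ.+ d))   ≡⟨ ring C (+ x) (+ d) ⟩
          C * (+ d * (+ x + + x + + d))                       ≡⟨ cong (λ s → C * (+ d * s)) (sym (trans (ℤP.pos-+ (x ℕ.+ x) d) (cong (_+ + d) (ℤP.pos-+ x x)))) ⟩
          C * (+ d * + (x ℕ.+ x ℕ.+ d))                       ∎
          where open ≡-Reasoning

    scaled-squares-distinct : ∀ C x y → ¬ p∣ C → x ℕ.< h → y ℕ.< h → x ≢ y → ¬ p∣ (C * + x * + x - C * + y * + y)
    scaled-squares-distinct C x y p∤C x<h y<h x≢y p∣diff with ℕP.<-cmp x y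
    ... | tri< x<y _ _ = scaled-squares-distinct< C x y p∤C x<y y<h p∣diff
    ... | tri≈ _ x≡y _ = x≢y x≡y
    ... | tri> _ _ y<x = scaled-squares-distinct< C y x p∤C y<x x<h (p∣-≡ (ring C (+ x) (+ y)) (p∣-neg p∣diff))
      where
      ring : ∀ C x y → - (C * x * x - C * y * y) ≡ C * y * y - C * x * x
      ring = solve-∀

  -- Pigeonhole: with h = (p + 1)/2, the values A L² and K - M² for L, M < h are 2h > p residues,
  -- and two of them cannot coincide within one family.
  binary-form-represents : ∀ A K → ¬ p∣ A → ∃₂ λ L M → p∣ (A * L * L + M * M - K)
  binary-form-represents A K p∤A = fromCollision (FinP.pigeonhole p<h+h (value ∘ splitAt h))
    where
    Represented : Set
    Represented = ∃₂ λ L M → p∣ (A * L * L + M * M - K)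
    value : Fin h ⊎ Fin h → Fin p
    value = [ (λ L → reduce (A * + toℕ L * + toℕ L)) , (λ M → reduce (K - + toℕ M * + toℕ M)) ]
    p<h+h : p ℕ.< h ℕ.+ h
    p<h+h = subst (ℕ._< h ℕ.+ h) (sym p≡2h-1) (s≤s (ℕP.≤-reflexive (sym (ℕP.+-suc _ _))))
    ring₁ : ∀ K a b → (K - a * a) - (K - b * b) ≡ + 1 * b * b - + 1 * a * a
    ring₁ = solve-∀
    ring₂ : ∀ A K a b → A * a * a - (K - b * b) ≡ A * a * a + b * b - K
    ring₂ = solve-∀
    ring₃ : ∀ A K a b → - ((K - a * a) - A * b * b) ≡ A * b * b + a * a - K
    ring₃ = solve-∀
    collision : ∀ x y → x ≢ y → value x ≡ value y → Represented
    collision (inj₁ a) (inj₁ b) a≢b eq = ⊥-elim (scaled-squares-distinct A (toℕ a) (toℕ b) p∤A (FinP.toℕ<n a) (FinP.toℕ<n b)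
      (λ e → a≢b (cong inj₁ (FinP.toℕ-injective e))) (reduce-≡⇒p∣- (A * + toℕ a * + toℕ a) (A * + toℕ b * + toℕ b) eq))
    collision (inj₂ a) (inj₂ b) a≢b eq = ⊥-elim (scaled-squares-distinct (+ 1) (toℕ b) (toℕ a) p∤1 (FinP.toℕ<n b) (FinP.toℕ<n a)
      (λ e → a≢b (cong inj₂ (FinP.toℕ-injective (sym e)))) (p∣-≡ (ring₁ K (+ toℕ a) (+ toℕ b)) (reduce-≡⇒p∣- (K - + toℕ a * + toℕ a) (K - + toℕ b * + toℕ b) eq)))
    collision (inj₁ a) (inj₂ b) _ eq = + toℕ a , + toℕ b , p∣-≡ (ring₂ A K (+ toℕ a) (+ toℕ b)) (reduce-≡⇒p∣- (A * + toℕ a * + toℕ a) (K - + toℕ b * + toℕ b) eq)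
    collision (inj₂ a) (inj₁ b) _ eq = + toℕ b , + toℕ a , p∣-≡ (ring₃ A K (+ toℕ a) (+ toℕ b)) (p∣-neg (reduce-≡⇒p∣- (K - + toℕ a * + toℕ a) (A * + toℕ b * + toℕ b) eq))
    fromCollision : (∃₂ λ i j → i Fin.< j × value (splitAt h i) ≡ value (splitAt h j)) → Represented
    fromCollision (i , j , i<j , eq) = collision (splitAt h i) (splitAt h j)
      (λ e → FinP.<⇒≢ i<j (trans (sym (FinP.join-splitAt h h i)) (trans (cong (join h h) e) (FinP.join-splitAt h h j)))) eq

  Primitive₃ : ℤ → ℤ → ℤ → Set
  Primitive₃ s₀ s₁ s₂ = ¬ p∣ s₀ ⊎ ¬ p∣ s₁ ⊎ ¬ p∣ s₂

  -- When p ∤ a and p ∤ Δ = ab - d², completing squares twice gives, for the x below,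
  -- a Δ q(x) = (a Δ)² (Δ L² + M² + Δ (ac - e²) - (af - de)²).
  ternary-form-isotropic : ∀ a b c d e f → ∃₂ λ s₀ s₁ → ∃ λ s₂ → p∣ (ternaryForm a b c d e f s₀ s₁ s₂) × Primitive₃ s₀ s₁ s₂
  ternary-form-isotropic a b c d e f with p∣? a
  ... | yes p∣a = + 1 , + 0 , + 0 , p∣-≡ (sym (ring₁ a b c d e f)) p∣a , inj₁ p∤1
    where
    ring₁ : ∀ a b c d e f → a * + 1 * + 1 + b * + 0 * + 0 + c * + 0 * + 0 + (d * + 1 * + 0 + d * + 0 * + 1)
                              + (e * + 1 * + 0 + e * + 0 * + 1) + (f * + 0 * + 0 + f * + 0 * + 0) ≡ a
    ring₁ = solve-∀
  ... | no p∤a with p∣? (a * b - d * d)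
  ...   | yes p∣Δ = - d , a , + 0 , p∣-cancelˡ a _ p∤a (p∣-≡ (sym (ring₂ a b c d e f)) (p∣-*ʳ a (p∣-*ʳ a p∣Δ))) , inj₂ (inj₁ p∤a)
    where
    ring₂ : ∀ a b c d e f → a * (a * (- d) * (- d) + b * a * a + c * + 0 * + 0 + (d * (- d) * a + d * a * (- d))
                                  + (e * (- d) * + 0 + e * + 0 * (- d)) + (f * a * + 0 + f * + 0 * a)) ≡ (a * b - d * d) * a * a
    ring₂ = solve-∀
  ...   | no p∤Δ with binary-form-represents (a * b - d * d) (- ((a * b - d * d) * (a * c - e * e) - (a * f - d * e) * (a * f - d * e))) p∤Δ
  ...     | L , M , p∣LM = x₁ , x₂ , x₃ , p∣-cancelˡ Δ _ p∤Δ (p∣-cancelˡ a _ p∤a (p∣-≡ (sym (ring₃ a b c d e f L M)) (p∣-*ˡ (x₃ * x₃) p∣LM))) , inj₂ (inj₂ (p∤-* a Δ p∤a p∤Δ))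
    where
    Δ = a * b - d * d
    x₁ = Δ * L - d * (M - (a * f - d * e)) - e * Δ
    x₂ = a * (M - (a * f - d * e))
    x₃ = a * Δ
    ring₃ : ∀ a b c d e f L M →
      let Δ = a * b - d * d ; x₁ = Δ * L - d * (M - (a * f - d * e)) - e * Δ ; x₂ = a * (M - (a * f - d * e)) ; x₃ = a * Δ in
      a * (Δ * (a * x₁ * x₁ + b * x₂ * x₂ + c * x₃ * x₃ + (d * x₁ * x₂ + d * x₂ * x₁) + (e * x₁ * x₃ + e * x₃ * x₁) + (f * x₂ * x₃ + f * x₃ * x₂)))
        ≡ x₃ * x₃ * (Δ * L * L + M * M - - (Δ * (a * c - e * e) - (a * f - d * e) * (a * f - d * e)))
    ring₃ = solve-∀

  IndependentModp : ∀ {N} → (Fin N → ℤ) → (Fin N → ℤ) → Set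
  IndependentModp {N} X Y = ∀ a b → (∀ i → p∣ (a * X i + b * Y i)) → p∣ a × p∣ b

  module FormModp {N : ℕ} (c : Fin N → Fin N → ℤ) (c-sym : ∀ i j → c i j ≡ c j i) where

    open BilinearForm c c-sym

    IsotropicPair : Set
    IsotropicPair = ∃₂ λ X Y → p∣ (β X X) × p∣ (β Y Y) × p∣ (β X Y) × IndependentModp X Y

    IsotropicInSpan₃ : (g₀ g₁ g₂ : Fin N → ℤ) → Set
    IsotropicInSpan₃ g₀ g₁ g₂ = ∃₂ λ s₀ s₁ → ∃ λ s₂ →
      p∣ (β (lin₃ s₀ s₁ s₂ g₀ g₁ g₂) (lin₃ s₀ s₁ s₂ g₀ g₁ g₂)) × Primitive₃ s₀ s₁ s₂

    isotropic-in-span₃ : ∀ g₀ g₁ g₂ → IsotropicInSpan₃ g₀ g₁ g₂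
    isotropic-in-span₃ g₀ g₁ g₂ with ternary-form-isotropic (β g₀ g₀) (β g₁ g₁) (β g₂ g₂) (β g₀ g₁) (β g₀ g₂) (β g₁ g₂)
    ... | s₀ , s₁ , s₂ , p∣q , prim = s₀ , s₁ , s₂ , p∣-≡ (sym (β-lin₃-diag s₀ s₁ s₂ g₀ g₁ g₂)) p∣q , prim

  module FormModp₅ {n} (c : Fin (5 ℕ.+ n) → Fin (5 ℕ.+ n) → ℤ) (c-sym : ∀ i j → c i j ≡ c j i) where

    open BilinearForm c c-sym
    open FormModp c c-sym

    -- Given the hypothesis on r in pair, the vectors r e_j - β(v, e_j) e_t (j ≠ k, t) are orthogonal to v
    -- mod p and vanish at k, so an isotropic combination w of three of them is independent of v.
    module FromPivot (v : Fin (5 ℕ.+ n) → ℤ) {k t : Fin (5 ℕ.+ n)} (k≢t : k ≢ t) (r : ℤ) where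

      φ : Fin (5 ℕ.+ n) → ℤ
      φ j = β v (basis j)

      u : Fin (5 ℕ.+ n) → Fin (5 ℕ.+ n) → ℤ
      u j = lin₂ r (- φ j) (basis j) (basis t)

      j₀ j₁ j₂ : Fin (5 ℕ.+ n)
      j₀ = other k≢t 0F
      j₁ = other k≢t 1F
      j₂ = other k≢t 2F

      w : ℤ → ℤ → ℤ → Fin (5 ℕ.+ n) → ℤ
      w s₀ s₁ s₂ = lin₃ s₀ s₁ s₂ (u j₀) (u j₁) (u j₂)

      v⊥w : (∀ j → j ≢ k → p∣ (φ j * r - φ j * φ t)) → ∀ s₀ s₁ s₂ → p∣ (β v (w s₀ s₁ s₂))
      v⊥w p∣φ s₀ s₁ s₂ = p∣-≡ (sym (β-lin₃ʳ s₀ s₁ s₂ (u j₀) (u j₁) (u j₂) v))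
        (p∣-+ (p∣-+ (p∣-*ˡ s₀ (v⊥u j₀ (other≢k k≢t 0F))) (p∣-*ˡ s₁ (v⊥u j₁ (other≢k k≢t 1F)))) (p∣-*ˡ s₂ (v⊥u j₂ (other≢k k≢t 2F))))
        where
        ring : ∀ r φ φₜ → r * φ + - φ * φₜ ≡ φ * r - φ * φₜ
        ring = solve-∀
        v⊥u : ∀ j → j ≢ k → p∣ (β v (u j))
        v⊥u j j≢k = p∣-≡ (sym (trans (β-lin₂ʳ r (- φ j) (basis j) (basis t) v) (ring r (φ j) (φ t)))) (p∣φ j j≢k)

      w-at : ∀ s₀ s₁ s₂ i {E₀ E₁ E₂} → basis j₀ i ≡ E₀ → basis j₁ i ≡ E₁ → basis j₂ i ≡ E₂ → basis t i ≡ + 0 →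
             w s₀ s₁ s₂ i ≡ r * (s₀ * E₀ + s₁ * E₁ + s₂ * E₂)
      w-at s₀ s₁ s₂ i refl refl refl tᵢ≡0 =
        trans (cong (λ T → s₀ * (r * basis j₀ i + - φ j₀ * T) + s₁ * (r * basis j₁ i + - φ j₁ * T) + s₂ * (r * basis j₂ i + - φ j₂ * T)) tᵢ≡0)
              (ring s₀ s₁ s₂ r (φ j₀) (φ j₁) (φ j₂) (basis j₀ i) (basis j₁ i) (basis j₂ i))
        where
        ring : ∀ s₀ s₁ s₂ r φ₀ φ₁ φ₂ E₀ E₁ E₂ → s₀ * (r * E₀ + - φ₀ * + 0) + s₁ * (r * E₁ + - φ₁ * + 0) + s₂ * (r * E₂ + - φ₂ * + 0)
               ≡ r * (s₀ * E₀ + s₁ * E₁ + s₂ * E₂)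
        ring = solve-∀

      w-at-pivot : ∀ s₀ s₁ s₂ → w s₀ s₁ s₂ k ≡ r * (s₀ * + 0 + s₁ * + 0 + s₂ * + 0)
      w-at-pivot s₀ s₁ s₂ =
        w-at s₀ s₁ s₂ k (basis-diff (other≢k k≢t 0F)) (basis-diff (other≢k k≢t 1F)) (basis-diff (other≢k k≢t 2F)) (basis-diff (k≢t ∘ sym))

      w-at-j₀ : ∀ s₀ s₁ s₂ → w s₀ s₁ s₂ j₀ ≡ r * (s₀ * + 1 + s₁ * + 0 + s₂ * + 0)
      w-at-j₀ s₀ s₁ s₂ = w-at s₀ s₁ s₂ j₀ (basis-same j₀) (basis-diff (other-≢ k≢t λ ())) (basis-diff (other-≢ k≢t λ ())) (basis-diff (other≢t k≢t 0F ∘ sym))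

      w-at-j₁ : ∀ s₀ s₁ s₂ → w s₀ s₁ s₂ j₁ ≡ r * (s₀ * + 0 + s₁ * + 1 + s₂ * + 0)
      w-at-j₁ s₀ s₁ s₂ = w-at s₀ s₁ s₂ j₁ (basis-diff (other-≢ k≢t λ ())) (basis-same j₁) (basis-diff (other-≢ k≢t λ ())) (basis-diff (other≢t k≢t 1F ∘ sym))

      w-at-j₂ : ∀ s₀ s₁ s₂ → w s₀ s₁ s₂ j₂ ≡ r * (s₀ * + 0 + s₁ * + 0 + s₂ * + 1)
      w-at-j₂ s₀ s₁ s₂ = w-at s₀ s₁ s₂ j₂ (basis-diff (other-≢ k≢t λ ())) (basis-diff (other-≢ k≢t λ ())) (basis-same j₂) (basis-diff (other≢t k≢t 2F ∘ sym))

      independent : ¬ p∣ (v k) → ¬ p∣ r → ∀ {s₀ s₁ s₂} → Primitive₃ s₀ s₁ s₂ → IndependentModp v (w s₀ s₁ s₂)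
      independent p∤vₖ p∤r {s₀} {s₁} {s₂} prim a b p∣avᵢ+bwᵢ = p∣a , p∣b prim
        where
        ring-k : ∀ a vₖ b r s₀ s₁ s₂ → a * vₖ + b * (r * (s₀ * + 0 + s₁ * + 0 + s₂ * + 0)) ≡ vₖ * a
        ring-k = solve-∀
        p∣a : p∣ a
        p∣a = p∣-cancelˡ (v k) a p∤vₖ
          (p∣-≡ (trans (cong (λ wₖ → a * v k + b * wₖ) (w-at-pivot s₀ s₁ s₂)) (ring-k a (v k) b r s₀ s₁ s₂)) (p∣avᵢ+bwᵢ k))
        ring-b : ∀ a vᵢ b wᵢ → a * vᵢ + b * wᵢ + - (a * vᵢ) ≡ wᵢ * b
        ring-b = solve-∀
        p∣b-at : ∀ i s → w s₀ s₁ s₂ i ≡ s * r → ¬ p∣ s → p∣ b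
        p∣b-at i s wᵢ≡sr p∤s = p∣-cancelˡ (s * r) b (p∤-* s r p∤s p∤r)
          (p∣-≡ (trans (ring-b a (v i) b _) (cong (ℤ._* b) wᵢ≡sr)) (p∣-+ (p∣avᵢ+bwᵢ i) (p∣-neg (p∣-*ʳ (v i) p∣a))))
        ring₀ : ∀ r s₀ s₁ s₂ → r * (s₀ * + 1 + s₁ * + 0 + s₂ * + 0) ≡ s₀ * r
        ring₀ = solve-∀
        ring₁ : ∀ r s₀ s₁ s₂ → r * (s₀ * + 0 + s₁ * + 1 + s₂ * + 0) ≡ s₁ * r
        ring₁ = solve-∀
        ring₂ : ∀ r s₀ s₁ s₂ → r * (s₀ * + 0 + s₁ * + 0 + s₂ * + 1) ≡ s₂ * r
        ring₂ = solve-∀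
        p∣b : Primitive₃ s₀ s₁ s₂ → p∣ b
        p∣b (inj₁ p∤s₀)        = p∣b-at j₀ s₀ (trans (w-at-j₀ s₀ s₁ s₂) (ring₀ r s₀ s₁ s₂)) p∤s₀
        p∣b (inj₂ (inj₁ p∤s₁)) = p∣b-at j₁ s₁ (trans (w-at-j₁ s₀ s₁ s₂) (ring₁ r s₀ s₁ s₂)) p∤s₁
        p∣b (inj₂ (inj₂ p∤s₂)) = p∣b-at j₂ s₂ (trans (w-at-j₂ s₀ s₁ s₂) (ring₂ r s₀ s₁ s₂)) p∤s₂

      pair : p∣ (β v v) → ¬ p∣ (v k) → ¬ p∣ r → (∀ j → j ≢ k → p∣ (φ j * r - φ j * φ t)) → IsotropicPair
      pair p∣vv p∤vₖ p∤r p∣φ = fromSpan (isotropic-in-span₃ (u j₀) (u j₁) (u j₂))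
        where
        fromSpan : IsotropicInSpan₃ (u j₀) (u j₁) (u j₂) → IsotropicPair
        fromSpan (s₀ , s₁ , s₂ , p∣ww , prim) = v , w s₀ s₁ s₂ , p∣vv , p∣ww , v⊥w p∣φ s₀ s₁ s₂ , independent p∤vₖ p∤r prim

    isotropic-pair : IsotropicPair
    isotropic-pair = fromSpan (isotropic-in-span₃ (basis 0F) (basis 1F) (basis 2F))
      where
      fromSpan : IsotropicInSpan₃ (basis 0F) (basis 1F) (basis 2F) → IsotropicPair
      fromSpan (s₀ , s₁ , s₂ , p∣vv , prim) = fromPivot (pivot prim)
        where
        v = lin₃ s₀ s₁ s₂ (basis 0F) (basis 1F) (basis 2F)
        φ : Fin (5 ℕ.+ n) → ℤ
        φ j = β v (basis j)
        Pivot : Set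
        Pivot = Σ (Fin (5 ℕ.+ n)) λ k → ¬ p∣ (v k) × k ≢ 3F
        ring₀ : ∀ s₀ s₁ s₂ → s₀ * + 1 + s₁ * + 0 + s₂ * + 0 ≡ s₀
        ring₀ = solve-∀
        ring₁ : ∀ s₀ s₁ s₂ → s₀ * + 0 + s₁ * + 1 + s₂ * + 0 ≡ s₁
        ring₁ = solve-∀
        ring₂ : ∀ s₀ s₁ s₂ → s₀ * + 0 + s₁ * + 0 + s₂ * + 1 ≡ s₂
        ring₂ = solve-∀
        pivot : Primitive₃ s₀ s₁ s₂ → Pivot
        pivot (inj₁ p∤s₀)        = 0F , (p∤s₀ ∘ p∣-≡ (ring₀ s₀ s₁ s₂)) , (λ ())
        pivot (inj₂ (inj₁ p∤s₁)) = 1F , (p∤s₁ ∘ p∣-≡ (ring₁ s₀ s₁ s₂)) , (λ ())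
        pivot (inj₂ (inj₂ p∤s₂)) = 2F , (p∤s₂ ∘ p∣-≡ (ring₂ s₀ s₁ s₂)) , (λ ())
        -- If β(v, e_j) ≡ 0 for all j ≠ k, then any t ≠ k works with r = 1.
        fromPivot : Pivot → IsotropicPair
        fromPivot (k , p∤vₖ , k≢3) = fromWitness (FinP.any? (λ t → ¬? (t Fin.≟ k) ×-dec ¬? (p∣? (φ t))))
          where
          fromWitness : Dec (∃ λ t → t ≢ k × ¬ p∣ (φ t)) → IsotropicPair
          fromWitness (yes (t , t≢k , p∤φₜ)) = FromPivot.pair v (t≢k ∘ sym) (φ t) p∣vv p∤vₖ p∤φₜ (λ j _ → p∣-x-x (φ j * φ t))
          fromWitness (no no-t) = FromPivot.pair v k≢3 (+ 1) p∣vv p∤vₖ p∤1 p∣φⱼ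
            where
            ring : ∀ x y → x * + 1 - x * y ≡ x * (+ 1 - y)
            ring = solve-∀
            p∣φⱼ : ∀ j → j ≢ k → p∣ (φ j * + 1 - φ j * φ 3F)
            p∣φⱼ j j≢k = fromDec (p∣? (φ j))
              where
              fromDec : Dec (p∣ (φ j)) → p∣ (φ j * + 1 - φ j * φ 3F)
              fromDec (yes p∣φⱼ) = p∣-≡ (sym (ring (φ j) (φ 3F))) (p∣-*ʳ (+ 1 - φ 3F) p∣φⱼ)
              fromDec (no p∤φⱼ) = ⊥-elim (no-t (j , j≢k , p∤φⱼ))

-- The discriminant form on (ℤ/mℤ)ⁿ

module DiscriminantForm (K n : ℕ) (Q : G (suc K) n → ℚ) (isDF : IsDiscriminantForm Q) where

  open IsDiscriminantForm isDF
  open ℚ/ℤ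
  open ℚSolver.+-*-Solver using (solve; _:+_; _:-_; _:*_; :-_; con; _:=_)

  m : ℕ
  m = suc K

  Gₘ : Set
  Gₘ = G m n

  B : Gₘ → Gₘ → ℚ
  B = Bil Q

  ⟦_⟧ : Fin m → ℤ
  ⟦ x ⟧ = + toℕ x

  red-⟦⟧ : ∀ x → red K ⟦ x ⟧ ≡ x
  red-⟦⟧ x = FinP.toℕ-injective (trans (FinP.toℕ-fromℕ< (n%ℕd<d ⟦ x ⟧ m)) (ℕM.m<n⇒m%n≡m (FinP.toℕ<n x)))

  red-m* : ∀ x → red K (+ m ℤ.* + x) ≡ Fin.zero
  red-m* x = FinP.toℕ-injective (begin
    toℕ (red K (+ m ℤ.* + x))  ≡⟨ cong (toℕ ∘ red K) (ℤP.pos-* m x) ⟨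
    toℕ (red K (+ (m ℕ.* x)))  ≡⟨ FinP.toℕ-fromℕ< (n%ℕd<d (+ (m ℕ.* x)) m) ⟩
    (m ℕ.* x) ℕ.% m            ≡⟨ cong (ℕ._% m) (ℕP.*-comm m x) ⟩
    (x ℕ.* m) ℕ.% m            ≡⟨ ℕM.m*n%n≡0 x m ⟩
    0                          ∎)
    where open ≡-Reasoning

  0ᴳ : ∀ {l} → G m l
  0ᴳ {l} = replicate l Fin.zero

  0⊙ : ∀ {l} (γ : G m l) → (+ 0) ⊙ γ ≡ 0ᴳ
  0⊙ []      = refl
  0⊙ (_ ∷ γ) = cong (Fin.zero ∷_) (0⊙ γ)

  m⊙ : ∀ {l} (γ : G m l) → (+ m) ⊙ γ ≡ 0ᴳ
  m⊙ []      = refl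
  m⊙ (x ∷ γ) = cong₂ _∷_ (red-m* (toℕ x)) (m⊙ γ)

  ⊕-identityʳ : ∀ {l} (γ : G m l) → γ ⊕ 0ᴳ ≡ γ
  ⊕-identityʳ []      = refl
  ⊕-identityʳ (x ∷ γ) = cong₂ _∷_ (trans (cong (red K ∘ +_) (ℕP.+-identityʳ (toℕ x))) (red-⟦⟧ x)) (⊕-identityʳ γ)

  ⊕-comm : ∀ {l} (γ δ : G m l) → γ ⊕ δ ≡ δ ⊕ γ
  ⊕-comm []      []      = refl
  ⊕-comm (x ∷ γ) (y ∷ δ) = cong₂ _∷_ (cong (red K) (ℤP.+-comm ⟦ x ⟧ ⟦ y ⟧)) (⊕-comm γ δ)

  ⊕-self : ∀ {l} (γ : G m l) → γ ⊕ γ ≡ (+ 2) ⊙ γ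
  ⊕-self []      = refl
  ⊕-self (x ∷ γ) = cong₂ _∷_ (cong (red K) (ring ⟦ x ⟧)) (⊕-self γ)
    where
    ring : ∀ a → a ℤ.+ a ≡ + 2 ℤ.* a
    ring = solve-∀

  B-sym : ∀ γ δ → B γ δ ≡ B δ γ
  B-sym γ δ = trans (cong (λ γ+δ → Q γ+δ ℚ.- Q γ ℚ.- Q δ) (⊕-comm γ δ))
                    (solve 3 (λ a x y → a :- x :- y := a :- y :- x) refl (Q (δ ⊕ γ)) (Q γ) (Q δ))

  B-zeroˡ : ∀ w → B 0ᴳ w ≈ 0ℚ
  B-zeroˡ w = ≈-subst (cong (λ γ → B γ w) 0⊙0⊕0⊙0≡0) (solve 1 (λ x → con 0ℚ :* x :+ con 0ℚ :* x := con 0ℚ) refl (B 0ᴳ w))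
                (mk≈ (bilˡ (+ 0) (+ 0) 0ᴳ 0ᴳ w))
    where
    0⊙0⊕0⊙0≡0 : ((+ 0) ⊙ 0ᴳ) ⊕ ((+ 0) ⊙ 0ᴳ) ≡ 0ᴳ {n}
    0⊙0⊕0⊙0≡0 = trans (cong₂ _⊕_ (0⊙ 0ᴳ) (0⊙ 0ᴳ)) (⊕-identityʳ 0ᴳ)

  B-zeroʳ : ∀ w → B w 0ᴳ ≈ 0ℚ
  B-zeroʳ w = ≈-subst (B-sym 0ᴳ w) refl (B-zeroˡ w)

  m*B≈0 : ∀ u w → ℤ→ℚ (+ m) ℚ.* B u w ≈ 0ℚ
  m*B≈0 u w = ≈-trans (≈-sym (≈-subst B-m⊙u≡B0 (solve 2 (λ x y → x :+ con 0ℚ :* y := x) refl (ℤ→ℚ (+ m) ℚ.* B u w) (B u w))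
                                  (mk≈ (bilˡ (+ m) (+ 0) u u w))))
                      (B-zeroˡ w)
    where
    B-m⊙u≡B0 : B (((+ m) ⊙ u) ⊕ ((+ 0) ⊙ u)) w ≡ B 0ᴳ w
    B-m⊙u≡B0 = cong (λ γ → B γ w) (trans (cong₂ _⊕_ (m⊙ u) (0⊙ u)) (⊕-identityʳ 0ᴳ))

  linComb : List (ℤ × Gₘ) → Gₘ
  linComb []            = 0ᴳ
  linComb ((a , u) ∷ L) = (a ⊙ u) ⊕ ((+ 1) ⊙ linComb L)

  sumBˡ : List (ℤ × Gₘ) → Gₘ → ℚ
  sumBˡ []            w = 0ℚ
  sumBˡ ((a , u) ∷ L) w = ℤ→ℚ a ℚ.* B u w ℚ.+ sumBˡ L w

  sumBʳ : Gₘ → List (ℤ × Gₘ) → ℚ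
  sumBʳ w []            = 0ℚ
  sumBʳ w ((a , u) ∷ L) = ℤ→ℚ a ℚ.* B w u ℚ.+ sumBʳ w L

  private
    1*x≡x : ∀ x → 1ℚ ℚ.* x ≡ x
    1*x≡x = solve 1 (λ x → con 1ℚ :* x := x) refl

  B-linCombˡ : ∀ L w → B (linComb L) w ≈ sumBˡ L w
  B-linCombˡ []            w = B-zeroˡ w
  B-linCombˡ ((a , u) ∷ L) w = ≈-trans (mk≈ (bilˡ a (+ 1) u (linComb L) w))
    (≈-+ (≈-refl {ℤ→ℚ a ℚ.* B u w}) (≈-subst refl (1*x≡x (sumBˡ L w)) (≈-*ℤ (+ 1) (B-linCombˡ L w))))

  B-linCombʳ : ∀ w L → B w (linComb L) ≈ sumBʳ w L
  B-linCombʳ w []            = B-zeroʳ w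
  B-linCombʳ w ((a , u) ∷ L) = ≈-trans (mk≈ (bilʳ a (+ 1) w u (linComb L)))
    (≈-+ (≈-refl {ℤ→ℚ a ℚ.* B w u}) (≈-subst refl (1*x≡x (sumBʳ w L)) (≈-*ℤ (+ 1) (B-linCombʳ w L))))

  1/m : ℚ
  1/m = fromℚᵘ (mkℚᵘ (+ 1) K)

  m*1/m≡1 : ℤ→ℚ (+ m) ℚ.* 1/m ≡ 1ℚ
  m*1/m≡1 = ℚP.toℚᵘ-injective (ℚᵘP.≃-trans (ℚP.toℚᵘ-homo-* (ℤ→ℚ (+ m)) 1/m)
    (ℚᵘP.≃-trans (ℚᵘP.*-cong (ℚP.toℚᵘ-fromℚᵘ (mkℚᵘ (+ m) 0)) (ℚP.toℚᵘ-fromℚᵘ (mkℚᵘ (+ 1) K)))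
      (*≡* (trans (ring (+ m)) (cong (λ k → + 1 ℤ.* + suc k) (sym (ℕP.+-identityʳ K)))))))
    where
    ring : ∀ M → (M ℤ.* + 1) ℤ.* + 1 ≡ + 1 ℤ.* M
    ring = solve-∀

  frac : ℤ → ℚ
  frac z = ℤ→ℚ z ℚ.* 1/m

  x≡m*[x/m] : ∀ x → x ≡ ℤ→ℚ (+ m) ℚ.* (x ℚ.* 1/m)
  x≡m*[x/m] x = begin
    x                              ≡⟨ solve 1 (λ x → x :* con 1ℚ := x) refl x ⟨
    x ℚ.* 1ℚ                       ≡⟨ cong (x ℚ.*_) m*1/m≡1 ⟨
    x ℚ.* (ℤ→ℚ (+ m) ℚ.* 1/m)      ≡⟨ solve 3 (λ x M i → x :* (M :* i) := M :* (x :* i)) refl x (ℤ→ℚ (+ m)) 1/m ⟩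
    ℤ→ℚ (+ m) ℚ.* (x ℚ.* 1/m)      ∎
    where open ≡-Reasoning

  B-numerator : ∀ u w → Σ ℤ λ z → B u w ≡ frac z
  B-numerator u w = z , (begin
    B u w                              ≡⟨ x≡m*[x/m] (B u w) ⟩
    ℤ→ℚ (+ m) ℚ.* (B u w ℚ.* 1/m)      ≡⟨ solve 3 (λ M b i → M :* (b :* i) := (M :* b :- con 0ℚ) :* i) refl (ℤ→ℚ (+ m)) (B u w) 1/m ⟩
    (ℤ→ℚ (+ m) ℚ.* B u w ℚ.- 0ℚ) ℚ.* 1/m ≡⟨ cong (ℚ._* 1/m) z-eq ⟩
    frac z                             ∎)
    where
    open ≡-Reasoning
    z = proj₁ (un≈ (m*B≈0 u w))
    z-eq = proj₂ (un≈ (m*B≈0 u w))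

  frac-injective : ∀ {a b} → frac a ≡ frac b → a ≡ b
  frac-injective {a} {b} eq = ℤ→ℚ-injective (trans (x≡m*[x/m] (ℤ→ℚ a)) (trans (cong (ℤ→ℚ (+ m) ℚ.*_) eq) (sym (x≡m*[x/m] (ℤ→ℚ b)))))

  frac-+ : ∀ a b → frac (a ℤ.+ b) ≡ frac a ℚ.+ frac b
  frac-+ a b = trans (cong (ℚ._* 1/m) (ℤ→ℚ-+ a b)) (solve 3 (λ x y i → (x :+ y) :* i := x :* i :+ y :* i) refl (ℤ→ℚ a) (ℤ→ℚ b) 1/m)

  ℤ→ℚ*frac : ∀ a b → ℤ→ℚ a ℚ.* frac b ≡ frac (a ℤ.* b)
  ℤ→ℚ*frac a b = trans (solve 3 (λ a b i → a :* (b :* i) := a :* b :* i) refl (ℤ→ℚ a) (ℤ→ℚ b) 1/m) (cong (ℚ._* 1/m) (sym (ℤ→ℚ-* a b)))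

  frac-0 : frac (+ 0) ≡ 0ℚ
  frac-0 = solve 1 (λ i → con 0ℚ :* i := con 0ℚ) refl 1/m

  frac-*m≈0 : ∀ q → frac (q ℤ.* + m) ≈ 0ℚ
  frac-*m≈0 q = ≈-subst (sym (begin
    frac (q ℤ.* + m)          ≡⟨ cong frac (ℤP.*-comm q (+ m)) ⟩
    frac (+ m ℤ.* q)          ≡⟨ ℤ→ℚ*frac (+ m) q ⟨
    ℤ→ℚ (+ m) ℚ.* frac q      ≡⟨ x≡m*[x/m] (ℤ→ℚ q) ⟨
    ℤ→ℚ q                     ∎)) refl (ℤ→ℚ≈0 q)
    where open ≡-Reasoning

  Q-zero : Q 0ᴳ ≈ 0ℚ
  Q-zero = ≈-subst (cong Q (0⊙ 0ᴳ)) (solve 1 (λ x → con 0ℚ :* x := con 0ℚ) refl (Q 0ᴳ)) (mk≈ (quad (+ 0) 0ᴳ))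

  m²Q≈0 : ∀ γ → ℤ→ℚ (+ m ℤ.* + m) ℚ.* Q γ ≈ 0ℚ
  m²Q≈0 γ = ≈-trans (≈-sym (≈-subst (cong Q (m⊙ γ)) refl (mk≈ (quad (+ m) γ)))) Q-zero

  B-diag : ∀ γ → B γ γ ≈ ℤ→ℚ (+ 2) ℚ.* Q γ
  B-diag γ = ≈-subst (cong (λ γ+γ → Q γ+γ ℚ.- Q γ ℚ.- Q γ) (sym (⊕-self γ)))
                     (solve 1 (λ x → con (ℤ→ℚ (+ 4)) :* x :- x :- x := con (ℤ→ℚ (+ 2)) :* x) refl (Q γ))
    (≈-+ (≈-+ (mk≈ {Q ((+ 2) ⊙ γ)} {ℤ→ℚ (+ 2 ℤ.* + 2) ℚ.* Q γ} (quad (+ 2) γ)) (≈-refl {ℚ.- Q γ})) (≈-refl {ℚ.- Q γ}))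

  -- m² = 1 + 2T, so Q γ ≡ m² Q γ - T · 2 Q γ ≡ - T · B(γ, γ) mod ℤ.
  Q≈0-if-B≈0 : Odd m → ∀ γ → B γ γ ≈ 0ℚ → Q γ ≈ 0ℚ
  Q≈0-if-B≈0 (h , m-odd) γ Bγγ≈0 = ≈-subst (sym Qγ≡) (solve 1 (λ t → con 0ℚ :+ t :* con 0ℚ := con 0ℚ) refl (ℤ→ℚ (ℤ.- T)))
    (≈-+ (m²Q≈0 γ) (≈-*ℤ (ℤ.- T) (≈-trans (≈-sym (B-diag γ)) Bγγ≈0)))
    where
    T : ℤ
    T = + 2 ℤ.* + h ℤ.* + h ℤ.+ + 2 ℤ.* + h
    ring : ∀ H → (+ 1 ℤ.+ (H ℤ.+ H)) ℤ.* (+ 1 ℤ.+ (H ℤ.+ H)) ≡ + 1 ℤ.+ + 2 ℤ.* (+ 2 ℤ.* H ℤ.* H ℤ.+ + 2 ℤ.* H)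
    ring = solve-∀
    m²≡1+2T : ℤ→ℚ (+ m ℤ.* + m) ≡ 1ℚ ℚ.+ ℤ→ℚ (+ 2) ℚ.* ℤ→ℚ T
    m²≡1+2T = trans (cong ℤ→ℚ (trans (cong (λ z → z ℤ.* z) (trans (cong +_ m-odd) (cong (λ z → + 1 ℤ.+ z) (ℤP.pos-+ h h)))) (ring (+ h))))
                    (trans (ℤ→ℚ-+ (+ 1) (+ 2 ℤ.* T)) (cong (1ℚ ℚ.+_) (ℤ→ℚ-* (+ 2) T)))
    Qγ≡ : Q γ ≡ ℤ→ℚ (+ m ℤ.* + m) ℚ.* Q γ ℚ.+ ℤ→ℚ (ℤ.- T) ℚ.* (ℤ→ℚ (+ 2) ℚ.* Q γ)
    Qγ≡ = trans (solve 3 (λ x c t → x := (con 1ℚ :+ c :* t) :* x :+ (:- t) :* (c :* x)) refl (Q γ) (ℤ→ℚ (+ 2)) (ℤ→ℚ T))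
                (cong₂ (λ A C → A ℚ.* Q γ ℚ.+ C ℚ.* (ℤ→ℚ (+ 2) ℚ.* Q γ)) (sym m²≡1+2T) (sym (ℤ→ℚ-neg T)))

  infix 4 _≡ₘ_
  record _≡ₘ_ (x y : ℤ) : Set where
    constructor mk≡ₘ
    field m∣- : + m ℤS.∣ (x ℤ.- y)
  open _≡ₘ_ public

  ≡ₘ-reflexive : ∀ {x y} → x ≡ y → x ≡ₘ y
  ≡ₘ-reflexive {x} refl = mk≡ₘ (ℤS.divides (+ 0) (trans (ℤP.+-inverseʳ x) (sym (ℤP.*-zeroˡ (+ m)))))

  ≡ₘ-refl : ∀ x → x ≡ₘ x
  ≡ₘ-refl x = ≡ₘ-reflexive refl

  ≡ₘ-trans : ∀ {x y z} → x ≡ₘ y → y ≡ₘ z → x ≡ₘ z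
  ≡ₘ-trans {x} {y} {z} (mk≡ₘ m∣x-y) (mk≡ₘ m∣y-z) = mk≡ₘ (subst (+ m ℤS.∣_) (sym (ring x y z)) (ℤS.∣m∣n⇒∣m+n m∣x-y m∣y-z))
    where
    ring : ∀ x y z → x ℤ.- z ≡ (x ℤ.- y) ℤ.+ (y ℤ.- z)
    ring = solve-∀

  ≡ₘ-+ : ∀ {x x′ y y′} → x ≡ₘ y → x′ ≡ₘ y′ → x ℤ.+ x′ ≡ₘ y ℤ.+ y′
  ≡ₘ-+ {x} {x′} {y} {y′} (mk≡ₘ m∣x-y) (mk≡ₘ m∣x′-y′) = mk≡ₘ (subst (+ m ℤS.∣_) (sym (ring x x′ y y′)) (ℤS.∣m∣n⇒∣m+n m∣x-y m∣x′-y′))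
    where
    ring : ∀ x x′ y y′ → (x ℤ.+ x′) ℤ.- (y ℤ.+ y′) ≡ (x ℤ.- y) ℤ.+ (x′ ℤ.- y′)
    ring = solve-∀

  ≡ₘ-*ˡ : ∀ a {x y} → x ≡ₘ y → a ℤ.* x ≡ₘ a ℤ.* y
  ≡ₘ-*ˡ a {x} {y} (mk≡ₘ m∣x-y) = mk≡ₘ (subst (+ m ℤS.∣_) (sym (ring a x y)) (ℤS.∣n⇒∣m*n a m∣x-y))
    where
    ring : ∀ a x y → a ℤ.* x ℤ.- a ℤ.* y ≡ a ℤ.* (x ℤ.- y)
    ring = solve-∀

  red-≡ₘ : ∀ z → ⟦ red K z ⟧ ≡ₘ z
  red-≡ₘ z = mk≡ₘ (ℤS.divides (ℤ.- (z /ℕ m)) (begin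
    ⟦ red K z ⟧ ℤ.- z                                    ≡⟨ cong₂ ℤ._-_ (cong +_ (FinP.toℕ-fromℕ< (n%ℕd<d z m))) (a≡a%ℕn+[a/ℕn]*n z m) ⟩
    + (z %ℕ m) ℤ.- (+ (z %ℕ m) ℤ.+ z /ℕ m ℤ.* + m)     ≡⟨ ring (+ (z %ℕ m)) (z /ℕ m) (+ m) ⟩
    ℤ.- (z /ℕ m) ℤ.* + m                                 ∎))
    where
    open ≡-Reasoning
    ring : ∀ r q M → r ℤ.- (r ℤ.+ q ℤ.* M) ≡ (ℤ.- q) ℤ.* M
    ring = solve-∀

  coordinates : List (ℤ × Gₘ) → Fin n → ℤ
  coordinates []            j = + 0
  coordinates ((a , u) ∷ L) j = a ℤ.* ⟦ lookup u j ⟧ ℤ.+ coordinates L j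

  lookup-⊕⊙ : ∀ a b (γ δ : Gₘ) j → ⟦ lookup ((a ⊙ γ) ⊕ (b ⊙ δ)) j ⟧ ≡ₘ a ℤ.* ⟦ lookup γ j ⟧ ℤ.+ b ℤ.* ⟦ lookup δ j ⟧
  lookup-⊕⊙ a b γ δ j =
    ≡ₘ-trans (≡ₘ-trans (≡ₘ-reflexive (cong ⟦_⟧ (VecP.lookup-zipWith _+ₘ_ j (a ⊙ γ) (b ⊙ δ))))
                       (red-≡ₘ (⟦ lookup (a ⊙ γ) j ⟧ ℤ.+ ⟦ lookup (b ⊙ δ) j ⟧)))
      (≡ₘ-+ (≡ₘ-trans (≡ₘ-reflexive (cong ⟦_⟧ (VecP.lookup-map j (a ·ₘ_) γ))) (red-≡ₘ (a ℤ.* ⟦ lookup γ j ⟧)))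
            (≡ₘ-trans (≡ₘ-reflexive (cong ⟦_⟧ (VecP.lookup-map j (b ·ₘ_) δ))) (red-≡ₘ (b ℤ.* ⟦ lookup δ j ⟧))))

  lookup-linComb : ∀ L j → ⟦ lookup (linComb L) j ⟧ ≡ₘ coordinates L j
  lookup-linComb []            j = ≡ₘ-reflexive (cong ⟦_⟧ (VecP.lookup-replicate j Fin.zero))
  lookup-linComb ((a , u) ∷ L) j = ≡ₘ-trans (lookup-⊕⊙ a (+ 1) u (linComb L) j)
    (≡ₘ-+ (≡ₘ-refl (a ℤ.* ⟦ lookup u j ⟧)) (≡ₘ-trans (≡ₘ-*ˡ (+ 1) (lookup-linComb L j)) (≡ₘ-reflexive (ℤP.*-identityˡ (coordinates L j)))))

  IsZero-lookup : ∀ {l} {γ : G m l} → IsZero γ → ∀ j → ⟦ lookup γ j ⟧ ≡ + 0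
  IsZero-lookup (px All.∷ _)  Fin.zero    = cong +_ px
  IsZero-lookup (_ All.∷ pxs) (Fin.suc j) = IsZero-lookup pxs j

  IsZero-linComb⇒m∣ : ∀ a b L M → IsZero ((a ⊙ linComb L) ⊕ (b ⊙ linComb M)) →
                      ∀ j → + m ℤS.∣ (a ℤ.* coordinates L j ℤ.+ b ℤ.* coordinates M j)
  IsZero-linComb⇒m∣ a b L M is-zero j = subst (+ m ℤS.∣_) (ℤP.neg-involutive x) (ℤS.∣m⇒∣-m (subst (+ m ℤS.∣_) (ℤP.+-identityˡ (ℤ.- x))
    (m∣- (≡ₘ-trans (≡ₘ-reflexive (sym (IsZero-lookup is-zero j)))
                   (≡ₘ-trans (lookup-⊕⊙ a b (linComb L) (linComb M) j) (≡ₘ-+ (≡ₘ-*ˡ a (lookup-linComb L j)) (≡ₘ-*ˡ b (lookup-linComb M j))))))))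
    where
    x = a ℤ.* coordinates L j ℤ.+ b ℤ.* coordinates M j

IsotropicPlane : (p : ℕ) {m n : ℕ} (Q : G m n → ℚ) → Set
IsotropicPlane p {m} {n} Q = ∃₂ λ (δ μ : G m n) →
  (Q δ ≈ℚ/ℤ 0ℚ) × (Q μ ≈ℚ/ℤ 0ℚ) × (Bil Q δ μ ≈ℚ/ℤ 0ℚ) ×
  (∀ (a b : ℤ) → IsZero ((a ⊙ δ) ⊕ (b ⊙ μ)) → (+ p ∣ a) × (+ p ∣ b))

-- Exponent one

module ExponentOne (k n′ : ℕ) (p-prime : Prime (suc (suc k))) (p≢2 : suc (suc k) ≢ 2)
                   (Q : G (suc (suc k)) (5 ℕ.+ n′) → ℚ) (isDF : IsDiscriminantForm Q) where

  p : ℕ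
  p = suc (suc k)

  open ModPrime p p-prime p≢2
  open DiscriminantForm (suc k) (5 ℕ.+ n′) Q isDF
  open ℚ/ℤ
  open import Data.Integer using (_+_; _*_)

  basisᴳ : Fin 5 → Gₘ
  basisᴳ i = e 0F ∷ e 1F ∷ e 2F ∷ e 3F ∷ e 4F ∷ 0ᴳ
    where
    e : Fin 5 → Fin p
    e j with i Fin.≟ j
    ... | yes _ = Fin.suc Fin.zero
    ... | no _  = Fin.zero

  opaque
    c : Fin 5 → Fin 5 → ℤ
    c i j = proj₁ (B-numerator (basisᴳ i) (basisᴳ j))

    B-basisᴳ : ∀ i j → B (basisᴳ i) (basisᴳ j) ≡ frac (c i j)
    B-basisᴳ i j = proj₂ (B-numerator (basisᴳ i) (basisᴳ j))

  c-sym : ∀ i j → c i j ≡ c j i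
  c-sym i j = frac-injective (trans (sym (B-basisᴳ i j)) (trans (B-sym (basisᴳ i) (basisᴳ j)) (B-basisᴳ j i)))

  open BilinearForm c c-sym
  open FormModp c c-sym using (IsotropicPair)
  open FormModp₅ {0} c c-sym using (isotropic-pair)

  element : (Fin 5 → ℤ) → List (ℤ × Gₘ)
  element X = (X 0F , basisᴳ 0F) ∷ (X 1F , basisᴳ 1F) ∷ (X 2F , basisᴳ 2F) ∷ (X 3F , basisᴳ 3F) ∷ (X 4F , basisᴳ 4F) ∷ []

  ℤ→ℚ*frac-sum : ∀ {N} (f g : Fin N → ℤ) → ℚΣ.sum (λ i → ℤ→ℚ (f i) ℚ.* frac (g i)) ≡ frac (∑[ i < N ] (f i * g i))
  ℤ→ℚ*frac-sum {zero}  f g = sym frac-0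
  ℤ→ℚ*frac-sum {suc N} f g = trans (cong₂ ℚ._+_ (ℤ→ℚ*frac (f 0F) (g 0F)) (ℤ→ℚ*frac-sum (f ∘ Fin.suc) (g ∘ Fin.suc)))
                                   (sym (frac-+ (f 0F * g 0F) (∑[ i < N ] (f (Fin.suc i) * g (Fin.suc i)))))

  B-element : ∀ X Y → B (linComb (element X)) (linComb (element Y)) ≈ frac (β X Y)
  B-element X Y = ≈-trans (B-linCombˡ (element X) (linComb (element Y)))
    (≈-subst refl (trans (ℤ→ℚ*frac-sum X (λ i → ∑[ j < 5 ] (Y j * c i j))) (cong frac ∑X∑Yc≡β))
      (≈-sum λ i → ≈-*ℤ (X i) (row i)))
    where
    row : ∀ i → B (basisᴳ i) (linComb (element Y)) ≈ frac (∑[ j < 5 ] (Y j * c i j))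
    row i = ≈-subst refl (trans (ℚΣ.sum-cong-≗ λ j → cong (ℤ→ℚ (Y j) ℚ.*_) (B-basisᴳ i j)) (ℤ→ℚ*frac-sum Y (c i)))
              (B-linCombʳ (basisᴳ i) (element Y))
    ring : ∀ x y c → x * (y * c) ≡ x * c * y
    ring = solve-∀
    ∑X∑Yc≡β : ∑[ i < 5 ] (X i * ∑[ j < 5 ] (Y j * c i j)) ≡ β X Y
    ∑X∑Yc≡β = sum-cong-≗ λ i → trans (*-distribˡ-sum (X i) (λ j → Y j * c i j)) (sum-cong-≗ λ j → ring (X i) (Y j) (c i j))

  coordinates-element : ∀ X i → coordinates (element X) (i Fin.↑ˡ n′) ≡ X i
  coordinates-element X 0F = ring (X 0F) (X 1F) (X 2F) (X 3F) (X 4F)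
    where
    ring : ∀ x₀ x₁ x₂ x₃ x₄ → x₀ * + 1 + (x₁ * + 0 + (x₂ * + 0 + (x₃ * + 0 + (x₄ * + 0 + + 0)))) ≡ x₀
    ring = solve-∀
  coordinates-element X 1F = ring (X 0F) (X 1F) (X 2F) (X 3F) (X 4F)
    where
    ring : ∀ x₀ x₁ x₂ x₃ x₄ → x₀ * + 0 + (x₁ * + 1 + (x₂ * + 0 + (x₃ * + 0 + (x₄ * + 0 + + 0)))) ≡ x₁
    ring = solve-∀
  coordinates-element X 2F = ring (X 0F) (X 1F) (X 2F) (X 3F) (X 4F)
    where
    ring : ∀ x₀ x₁ x₂ x₃ x₄ → x₀ * + 0 + (x₁ * + 0 + (x₂ * + 1 + (x₃ * + 0 + (x₄ * + 0 + + 0)))) ≡ x₂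
    ring = solve-∀
  coordinates-element X 3F = ring (X 0F) (X 1F) (X 2F) (X 3F) (X 4F)
    where
    ring : ∀ x₀ x₁ x₂ x₃ x₄ → x₀ * + 0 + (x₁ * + 0 + (x₂ * + 0 + (x₃ * + 1 + (x₄ * + 0 + + 0)))) ≡ x₃
    ring = solve-∀
  coordinates-element X 4F = ring (X 0F) (X 1F) (X 2F) (X 3F) (X 4F)
    where
    ring : ∀ x₀ x₁ x₂ x₃ x₄ → x₀ * + 0 + (x₁ * + 0 + (x₂ * + 0 + (x₃ * + 0 + (x₄ * + 1 + + 0)))) ≡ x₄
    ring = solve-∀

  p∣⇒frac≈0 : ∀ {x} → p∣ x → frac x ≈ 0ℚ
  p∣⇒frac≈0 {x} p∣x = ≈-subst (cong frac (sym (ℤS._∣_.equality p∣′x))) refl (frac-*m≈0 (ℤS.quotient p∣′x))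
    where
    p∣′x = ℤS.∣ᵤ⇒∣ {+ p} {x} (un∣ p∣x)

  plane : IsotropicPlane p Q
  plane = fromPair isotropic-pair
    where
    fromPair : IsotropicPair → IsotropicPlane p Q
    fromPair (X , Y , p∣XX , p∣YY , p∣XY , X,Y-independent) =
      δ , μ , un≈ (Q≈0-if-B≈0 p-odd δ (≈-trans (B-element X X) (p∣⇒frac≈0 p∣XX))) ,
              un≈ (Q≈0-if-B≈0 p-odd μ (≈-trans (B-element Y Y) (p∣⇒frac≈0 p∣YY))) ,
              un≈ (≈-trans (B-element X Y) (p∣⇒frac≈0 p∣XY)) , independent
      where
      δ = linComb (element X)
      μ = linComb (element Y)
      independent : ∀ a b → IsZero ((a ⊙ δ) ⊕ (b ⊙ μ)) → (+ p ∣ a) × (+ p ∣ b)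
      independent a b is-zero = un∣ (proj₁ p∣a×p∣b) , un∣ (proj₂ p∣a×p∣b)
        where
        p∣a×p∣b = X,Y-independent a b λ i → mk∣ (ℤS.∣⇒∣ᵤ (subst (+ p ℤS.∣_)
          (cong₂ (λ x y → a * x + b * y) (coordinates-element X i) (coordinates-element Y i))
          (IsZero-linComb⇒m∣ a b (element X) (element Y) is-zero (i Fin.↑ˡ n′))))

-- Exponent at least two

module SquareZero (k n′ : ℕ) (Q : G (suc (suc k)) (2 ℕ.+ n′) → ℚ) (isDF : IsDiscriminantForm Q)
                  (m-odd : Odd (suc (suc k))) (p r : ℕ) (m≡p*r : suc (suc k) ≡ p ℕ.* r) (p∣r : p ℕD.∣ r) where

  open DiscriminantForm (suc k) (2 ℕ.+ n′) Q isDF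
  open ℚ/ℤ
  open ℚSolver.+-*-Solver using (solve; _:+_; _:*_; con; _:=_)
  open import Data.Integer using (_+_; _*_)

  instance
    r-nonZero : ℕ.NonZero r
    r-nonZero = ℕ.≢-nonZero λ r≡0 → ℕP.1+n≢0 (trans m≡p*r (trans (cong (p ℕ.*_) r≡0) (ℕP.*-zeroʳ p)))

  e₁ e₂ : Gₘ
  e₁ = Fin.suc Fin.zero ∷ Fin.zero ∷ 0ᴳ
  e₂ = Fin.zero ∷ Fin.suc Fin.zero ∷ 0ᴳ

  r· : Gₘ → List (ℤ × Gₘ)
  r· u = (+ r , u) ∷ []

  r*r≡q*m : + r * + r ≡ + (ℕD.quotient p∣r) * + m
  r*r≡q*m = begin
    + r * + r                ≡⟨ ℤP.pos-* r r ⟨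
    + (r ℕ.* r)              ≡⟨ cong (λ x → + (x ℕ.* r)) (ℕD._∣_.equality p∣r) ⟩
    + (q ℕ.* p ℕ.* r)        ≡⟨ cong +_ (ℕP.*-assoc q p r) ⟩
    + (q ℕ.* (p ℕ.* r))      ≡⟨ cong (λ x → + (q ℕ.* x)) m≡p*r ⟨
    + (q ℕ.* m)              ≡⟨ ℤP.pos-* q m ⟩
    + q * + m                ∎
    where
    open ≡-Reasoning
    q = ℕD.quotient p∣r

  B-r·-r·≈0 : ∀ u v → B (linComb (r· u)) (linComb (r· v)) ≈ 0ℚ
  B-r·-r·≈0 u v = ≈-trans (B-linCombˡ (r· u) (linComb (r· v)))
    (≈-trans (≈-+ (≈-*ℤ (+ r) (B-linCombʳ u (r· v))) (≈-refl {0ℚ}))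
      (≈-subst (sym r²B≡qmB) (solve 1 (λ y → y :* con 0ℚ := con 0ℚ) refl (ℤ→ℚ q)) (≈-*ℤ q (m*B≈0 u v))))
    where
    q = + (ℕD.quotient p∣r)
    r²B≡qmB : ℤ→ℚ (+ r) ℚ.* (ℤ→ℚ (+ r) ℚ.* B u v ℚ.+ 0ℚ) ℚ.+ 0ℚ ≡ ℤ→ℚ q ℚ.* (ℤ→ℚ (+ m) ℚ.* B u v)
    r²B≡qmB = trans (solve 2 (λ x b → x :* (x :* b :+ con 0ℚ) :+ con 0ℚ := (x :* x) :* b) refl (ℤ→ℚ (+ r)) (B u v))
      (trans (cong (ℚ._* B u v) (trans (sym (ℤ→ℚ-* (+ r) (+ r))) (trans (cong ℤ→ℚ r*r≡q*m) (ℤ→ℚ-* q (+ m)))))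
             (solve 3 (λ y z b → (y :* z) :* b := y :* (z :* b)) refl (ℤ→ℚ q) (ℤ→ℚ (+ m)) (B u v)))

  m∣a*r⇒p∣a : ∀ a → + m ℤS.∣ (a * + r) → + p ∣ a
  m∣a*r⇒p∣a a m∣ar = ℤS.∣⇒∣ᵤ (ℤS.*-cancelʳ-∣ (+ r) {+ p} {a} (subst (ℤS._∣ (a * + r)) (trans (cong +_ m≡p*r) (ℤP.pos-* p r)) m∣ar))

  plane : IsotropicPlane p Q
  plane = δ , μ , un≈ (Q≈0-if-B≈0 m-odd δ (B-r·-r·≈0 e₁ e₁)) , un≈ (Q≈0-if-B≈0 m-odd μ (B-r·-r·≈0 e₂ e₂)) , un≈ (B-r·-r·≈0 e₁ e₂) , independent
    where
    δ = linComb (r· e₁)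
    μ = linComb (r· e₂)
    ring₁ : ∀ a b r → a * (r * + 1 + + 0) + b * (r * + 0 + + 0) ≡ a * r
    ring₁ = solve-∀
    ring₂ : ∀ a b r → a * (r * + 0 + + 0) + b * (r * + 1 + + 0) ≡ b * r
    ring₂ = solve-∀
    independent : ∀ a b → IsZero ((a ⊙ δ) ⊕ (b ⊙ μ)) → (+ p ∣ a) × (+ p ∣ b)
    independent a b is-zero =
      m∣a*r⇒p∣a a (subst (+ m ℤS.∣_) (ring₁ a b (+ r)) (IsZero-linComb⇒m∣ a b (r· e₁) (r· e₂) is-zero Fin.zero)) ,
      m∣a*r⇒p∣a b (subst (+ m ℤS.∣_) (ring₂ a b (+ r)) (IsZero-linComb⇒m∣ a b (r· e₁) (r· e₂) is-zero (Fin.suc Fin.zero)))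

IsotropicPlanes : (p m n : ℕ) → Set
IsotropicPlanes p m n = (Q : G m n → ℚ) → IsDiscriminantForm Q → IsotropicPlane p Q

lemma6p9 : (p e n : ℕ) → Prime p → p ≢ 2 →
    (e ≡ 1 × 5 ≤ n) ⊎ (2 ≤ e × 2 ≤ n) →
    (Q : G (p ^ e) n → ℚ) → IsDiscriminantForm Q →
    ∃₂ λ (δ μ : G (p ^ e) n) →
    (Q δ ≈ℚ/ℤ 0ℚ) × (Q μ ≈ℚ/ℤ 0ℚ) × (Bil Q δ μ ≈ℚ/ℤ 0ℚ) ×
    (∀ (a b : ℤ) → IsZero ((a ⊙ δ) ⊕ (b ⊙ μ)) → (+ p ∣ a) × (+ p ∣ b))
lemma6p9 0 _ _ ()
lemma6p9 1 _ _ ()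
lemma6p9 p@(suc (suc k)) _ n p-prime p≢2 (inj₁ (refl , 5≤n)) =
  subst₂ (IsotropicPlanes p) (sym (ℕP.*-identityʳ p)) (proj₂ n′)
    (ExponentOne.plane k (proj₁ n′) p-prime p≢2)
  where
  n′ = ℕP.m≤n⇒∃[o]m+o≡n 5≤n
lemma6p9 p@(suc (suc _)) (suc (suc f)) n p-prime p≢2 (inj₂ (s≤s (s≤s z≤n) , 2≤n)) =
  subst₂ (IsotropicPlanes p) m≡pᵉ (proj₂ n′)
    (λ Q isDF → SquareZero.plane (pᵉ ℕ.∸ 2) (proj₁ n′) Q isDF (subst Odd (sym m≡pᵉ) pᵉ-odd)
                                 p (p ^ suc f) m≡pᵉ (ℕD.m∣m*n (p ^ f)))
  where
  pᵉ = p ^ suc (suc f)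
  m≡pᵉ : suc (suc (pᵉ ℕ.∸ 2)) ≡ pᵉ
  m≡pᵉ = ℕP.m+[n∸m]≡n (ℕP.≤-trans (s≤s (s≤s z≤n)) (ℕP.m≤m*n p (p ^ suc f) {{ℕP.m^n≢0 p (suc f)}}))
  pᵉ-odd = odd-^ (ModPrime.p-odd p p-prime p≢2) (suc (suc f))
  n′ = ℕP.m≤n⇒∃[o]m+o≡n 2≤n
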